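{- (1) Let $m>n\ge2$ be integers with $n\mid m(m-1)$. The only quasi-symmetric 2-designs of defect $1$ whose block graph is a Steiner graph $S_n(m)$ are the Steiner 2-designs and their complements. (2) For each fixed pair of integers $\mu\ge2$, $n\ge2$, there are (up to isomorphism) only finitely many quasi-symmetric 2-designs of defect $\mu$ whose block graph is a Steiner graph $S_n(m)$ for some $m$.
   Context: A Steiner 2-design is a 2-design with $\lambda=1$. For integers $m>n\ge2$ with $n\mid m(m-1)$, a Steiner graph $S_n(m)$ is the block graph of some Steiner 2-design with parameters $v=mn-m+1$, $k=n$, $\lambda=1$, $r=m$, $b=\frac{m}{n}(mn-m+1)$, i.e. the graph on its blocks with two blocks adjacent iff they meet in a point (there may be several non-isomorphic such graphs). A quasi-symmetric 2-design is a 2-design with exactly two block intersection numbers $\lambda_1<\lambda_2$; its defect is $\lambda_2-\lambda_1$ and its block graph has the blocks as vertices, adjacent iff they meet in $\lambda_2$ points. The complement of a design has the complements of its blocks as blocks. -}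

module Defs where

open import Data.Nat using (ℕ; _+_; _*_; _∸_; _<_; _≤_)
open import Data.Nat.Divisibility using (_∣_)
open import Data.Bool using (Bool; _∧_)
open import Data.Fin using (Fin)
open import Data.Fin.Subset using (Subset; _∩_; ∁; ∣_∣)
open import Data.Vec using (tabulate; lookup)
open import Data.Product using (Σ; ∃; _×_)
open import Data.Sum using (_⊎_)
open import Relation.Binary.PropositionalEquality using (_≡_; _≢_)
open import Function.Bundles using (_↔_; Inverse; _⇔_)

-- An incidence structure: points Fin v, blocks indexed by Fin b
-- (repeated blocks allowed, as for general designs).
record Design : Set where
  constructor design
  field
    v      : ℕ
    b      : ℕ
    blocks : Fin b → Subset v
open Design public

blocksThrough : (D : Design) → Fin (v D) → Fin (v D) → Subset (b D)
blocksThrough D x y = tabulate (λ i → lookup (blocks D i) x ∧ lookup (blocks D i) y)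

IsDesign : Design → ℕ → ℕ → Set
IsDesign D k lam =
  (k < v D) × (1 ≤ lam) ×
  (∀ i → ∣ blocks D i ∣ ≡ k) ×
  (∀ x y → x ≢ y → ∣ blocksThrough D x y ∣ ≡ lam)

Is2Design : Design → Set
Is2Design D = Σ ℕ λ k → Σ ℕ λ l → IsDesign D k l

IsSteiner : Design → Set
IsSteiner D = Σ ℕ λ k → IsDesign D k 1

complement : Design → Design
complement D = design (v D) (b D) (λ i → ∁ (blocks D i))

inter : (D : Design) → Fin (b D) → Fin (b D) → ℕ
inter D i j = ∣ blocks D i ∩ blocks D j ∣

IsQuasiSymmetric : Design → ℕ → ℕ → Set
IsQuasiSymmetric D λ₁ λ₂ =
  Is2Design D × (λ₁ < λ₂) ×
  (∀ i j → i ≢ j → (inter D i j ≡ λ₁) ⊎ (inter D i j ≡ λ₂)) ×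
  (Σ (Fin (b D)) λ i → Σ (Fin (b D)) λ j → i ≢ j × inter D i j ≡ λ₁) ×
  (Σ (Fin (b D)) λ i → Σ (Fin (b D)) λ j → i ≢ j × inter D i j ≡ λ₂)

record Graph : Set₁ where
  constructor graph
  field
    N   : ℕ
    Adj : Fin N → Fin N → Set
open Graph public

_≅G_ : Graph → Graph → Set
G ≅G H = Σ (Fin (N G) ↔ Fin (N H)) λ f →
  ∀ i j → Adj G i j ⇔ Adj H (Inverse.to f i) (Inverse.to f j)

qsBlockGraph : Design → ℕ → Graph
qsBlockGraph D λ₂ = graph (b D) (λ i j → i ≢ j × inter D i j ≡ λ₂)

steinerBlockGraph : Design → Graph
steinerBlockGraph D = graph (b D) (λ i j → i ≢ j × 1 ≤ inter D i j)

IsSteinerGraph : ℕ → ℕ → Graph → Set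
IsSteinerGraph n m G =
  (2 ≤ n) × (n < m) × (n ∣ m * (m ∸ 1)) ×
  (Σ Design λ E → (v E ≡ m * n ∸ m + 1) × IsDesign E n 1 × (G ≅G steinerBlockGraph E))

_≅D_ : Design → Design → Set
D ≅D E = Σ (Fin (v D) ↔ Fin (v E)) λ σ → Σ (Fin (b D) ↔ Fin (b E)) λ τ →
  ∀ x i → lookup (blocks D i) x ≡ lookup (blocks E (Inverse.to τ i)) (Inverse.to σ x)

{-# OPTIONS --safe #-}
module Submission where

-- Let N be the incidence matrix of the quasi-symmetric design D and A the adjacency matrix of its
-- block graph. The intersection matrix NᵀN equals λ₁J + μA + (k − λ₁)I and satisfies
-- (NᵀN)² = (r − λ)NᵀN + λk²J. When the block graph is the block graph of a Steiner system
-- 2-(mn − m + 1, n, 1), A² is known (degree n(m − 1), common neighbours m − 2 + (n − 1)² and n²),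
-- and comparing entries gives k − λ₁ = μn and r = λ + μ(m − 1). Together with the basic design
-- equations this forces (m − 1 + n(b − m))(r − m)(b − m − r) = (μ − 1)(m − 1)bn(b − m).
-- For μ = 1 either r = m, so λ = 1, or b = m + r, so the complement has λ = 1.
-- For μ ≥ 2 the identity bounds m, hence b and v, by a function of μ and n.

open import Data.Bool using (Bool; true; false; _∧_; not)
open import Data.Fin using (Fin; zero; suc)
import Data.Fin.Properties as Fin
open import Data.Fin.Subset using (Subset; ∣_∣; _∩_; ∁)
open import Data.Vec using ([]; _∷_; lookup)
open import Data.Vec.Properties using (lookup-zipWith; lookup∘tabulate; lookup-map)
open import Data.Product using (Σ; _×_; _,_; proj₁; proj₂)
open import Data.Sum using (_⊎_; inj₁; inj₂; [_,_]′)
open import Data.Empty using (⊥-elim)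
open import Function.Bundles using (_↔_; Inverse; Equivalence; Injection)
open import Function.Properties.Inverse using (↔⇒↣)
open import Data.Fin.Permutation using (↔⇒≡)
open import Relation.Nullary using (Dec; yes; no; does; ¬_; contradiction)
open import Relation.Nullary.Decidable using (dec-true; dec-false; ¬?; _×-dec_; toSum)
open import Relation.Binary.PropositionalEquality
open import Data.List using (List; []; _∷_; _++_; map; concatMap; upTo)
open import Data.List.Relation.Unary.Any as Any using (Any; here)
open import Data.List.Relation.Unary.Any.Properties using (map⁺; concatMap⁺)
open import Data.List.Membership.Propositional using (_∈_)
open import Data.List.Membership.Propositional.Properties using (∈-map⁺; ∈-++⁺ˡ; ∈-++⁺ʳ; ∈-upTo⁺)
open import Function.Construct.Identity using (↔-id)
import Data.Vec.Functional as V
open import Data.Nat.Divisibility using (_∣_)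
open import Defs


-- Each lemma writes its conclusion as an explicit polynomial combination of its hypotheses,
-- checked by the ring solver.
module ℤ-Identities where
  open import Data.Integer using (ℤ; 0ℤ; 1ℤ; _+_; _-_; _*_; -_)
  open import Data.Integer.Properties using (i≡j⇒i-j≡0; i-j≡0⇒i≡j; i*j≡0⇒i≡0∨j≡0)
  open import Data.Integer.Tactic.RingSolver using (solve-∀)

  cancelˡ : ∀ {μ X : ℤ} → μ ≢ 0ℤ → μ * X ≡ 0ℤ → X ≡ 0ℤ
  cancelˡ {μ} μ≢0 μX≡0 with i*j≡0⇒i≡0∨j≡0 μ μX≡0
  ... | inj₁ μ≡0 = ⊥-elim (μ≢0 μ≡0)
  ... | inj₂ X≡0 = X≡0

  PairEquation : (b x μ K λ′ k r d c α ε : ℤ) → Set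
  PairEquation b x μ K λ′ k r d c α ε =
    b * (x * x) + x * μ * d + x * μ * d + μ * μ * c + K * (x + μ * α) + K * (x + μ * α) + ε * (K * K)
      + λ′ * (x + μ * α + ε * K) ≡ λ′ * (k * k) + r * (x + μ * α + ε * K)

  adjacent-nonadjacent : ∀ (b x μ K k λ′ r d c₁ c₀ : ℤ) → μ ≢ 0ℤ →
    PairEquation b x μ K λ′ k r d c₁ 1ℤ 0ℤ → PairEquation b x μ K λ′ k r d c₀ 0ℤ 0ℤ →
    μ * (c₁ - c₀) + K + K + λ′ - r ≡ 0ℤ
  adjacent-nonadjacent b x μ K k λ′ r d c₁ c₀ μ≢0 adjacent nonadjacent =
    cancelˡ μ≢0 (trans (combination b x μ K k λ′ r d c₁ c₀) (cong₂ _-_ (i≡j⇒i-j≡0 adjacent) (i≡j⇒i-j≡0 nonadjacent)))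
    where
    combination : ∀ b x μ K k λ′ r d c₁ c₀ → μ * (μ * (c₁ - c₀) + K + K + λ′ - r) ≡
      (b * (x * x) + x * μ * d + x * μ * d + μ * μ * c₁ + K * (x + μ * 1ℤ) + K * (x + μ * 1ℤ) + 0ℤ * (K * K)
        + λ′ * (x + μ * 1ℤ + 0ℤ * K) - (λ′ * (k * k) + r * (x + μ * 1ℤ + 0ℤ * K)))
      - (b * (x * x) + x * μ * d + x * μ * d + μ * μ * c₀ + K * (x + μ * 0ℤ) + K * (x + μ * 0ℤ) + 0ℤ * (K * K)
        + λ′ * (x + μ * 0ℤ + 0ℤ * K) - (λ′ * (k * k) + r * (x + μ * 0ℤ + 0ℤ * K)))
    combination = solve-∀

  diagonal-factorisation : ∀ (b x μ K k λ′ r d c₀ c₁ c₂ n e : ℤ) →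
    PairEquation b x μ K λ′ k r d c₂ 0ℤ 1ℤ → PairEquation b x μ K λ′ k r d c₀ 0ℤ 0ℤ →
    μ * (c₁ - c₀) + K + K + λ′ - r ≡ 0ℤ →
    c₀ ≡ n * n → c₁ + n + n + 1ℤ ≡ n * n + (1ℤ + n + e) → c₂ + n ≡ (1ℤ + n + e) * n →
    (K - μ * n) * (K + μ * e) ≡ 0ℤ
  diagonal-factorisation b x μ K k λ′ r d c₀ c₁ c₂ n e diagonal nonadjacent X≡0 c₀≡ c₁≡ c₂≡ =
    trans (combination b x μ K k λ′ r d c₀ c₁ c₂ n e)
          (vanishes (i≡j⇒i-j≡0 diagonal) (i≡j⇒i-j≡0 nonadjacent) X≡0 (i≡j⇒i-j≡0 c₂≡) (i≡j⇒i-j≡0 c₀≡) (i≡j⇒i-j≡0 c₁≡))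
    where
    combination : ∀ b x μ K k λ′ r d c₀ c₁ c₂ n e → (K - μ * n) * (K + μ * e) ≡
      - ((b * (x * x) + x * μ * d + x * μ * d + μ * μ * c₂ + K * (x + μ * 0ℤ) + K * (x + μ * 0ℤ) + 1ℤ * (K * K)
           + λ′ * (x + μ * 0ℤ + 1ℤ * K) - (λ′ * (k * k) + r * (x + μ * 0ℤ + 1ℤ * K)))
         - (b * (x * x) + x * μ * d + x * μ * d + μ * μ * c₀ + K * (x + μ * 0ℤ) + K * (x + μ * 0ℤ) + 0ℤ * (K * K)
           + λ′ * (x + μ * 0ℤ + 0ℤ * K) - (λ′ * (k * k) + r * (x + μ * 0ℤ + 0ℤ * K))))
      + (μ * (c₁ - c₀) + K + K + λ′ - r) * K
      + (μ * μ * ((c₂ + n - (1ℤ + n + e) * n) - (c₀ - n * n)) - μ * K * ((c₁ + n + n + 1ℤ - (n * n + (1ℤ + n + e))) - (c₀ - n * n)))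
    combination = solve-∀
    vanishes : ∀ {s t X h₂ h₀ h₁} → s ≡ 0ℤ → t ≡ 0ℤ → X ≡ 0ℤ → h₂ ≡ 0ℤ → h₀ ≡ 0ℤ → h₁ ≡ 0ℤ →
      - (s - t) + X * K + (μ * μ * (h₂ - h₀) - μ * K * (h₁ - h₀)) ≡ 0ℤ
    vanishes refl refl refl refl refl refl = zeros μ K
      where
      zeros : ∀ μ K → - (0ℤ - 0ℤ) + 0ℤ * K + (μ * μ * (0ℤ - 0ℤ) - μ * K * (0ℤ - 0ℤ)) ≡ 0ℤ
      zeros = solve-∀

  replication-formula : ∀ (μ K λ′ r c₀ c₁ n e : ℤ) →
    μ * (c₁ - c₀) + K + K + λ′ - r ≡ 0ℤ → K ≡ μ * n →
    c₀ ≡ n * n → c₁ + n + n + 1ℤ ≡ n * n + (1ℤ + n + e) →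
    r ≡ λ′ + μ * (n + e)
  replication-formula μ K λ′ r c₀ c₁ n e X≡0 refl c₀≡ c₁≡ =
    i-j≡0⇒i≡j r (λ′ + μ * (n + e))
      (trans (combination μ λ′ r c₀ c₁ n e) (vanishes X≡0 (i≡j⇒i-j≡0 c₁≡) (i≡j⇒i-j≡0 c₀≡)))
    where
    combination : ∀ μ λ′ r c₀ c₁ n e → r - (λ′ + μ * (n + e)) ≡
      - (μ * (c₁ - c₀) + μ * n + μ * n + λ′ - r)
      + μ * ((c₁ + n + n + 1ℤ - (n * n + (1ℤ + n + e))) - (c₀ - n * n))
    combination = solve-∀
    vanishes : ∀ {X h₁ h₀} → X ≡ 0ℤ → h₁ ≡ 0ℤ → h₀ ≡ 0ℤ → - X + μ * (h₁ - h₀) ≡ 0ℤ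
    vanishes refl refl refl = zeros μ
      where
      zeros : ∀ μ → - 0ℤ + μ * (0ℤ - 0ℤ) ≡ 0ℤ
      zeros = solve-∀

  ParameterIdentity : (m n b r μ : ℤ) → Set
  ParameterIdentity m n b r μ = (m - 1ℤ + n * (b - m)) * (r - m) * (b - m - r) ≡ (μ - 1ℤ) * (m - 1ℤ) * b * n * (b - m)

  parameter-identity : ∀ (x r b v m n μ k λ′ : ℤ) → μ ≢ 0ℤ →
    k ≡ x + μ * n → r + μ ≡ λ′ + μ * m →
    b * x + μ * n * m ≡ k * r → k * r + λ′ ≡ v * λ′ + r → b * k ≡ v * r → b * n + m * m ≡ (m * n + 1ℤ) * m →
    ParameterIdentity m n b r μ
  parameter-identity x r b v m n μ k λ′ μ≢0 refl r+μ≡ E₁ E₂ E₃ E₄ =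
    i-j≡0⇒i≡j _ _ (cancelˡ μ≢0 (with-λ′ λ′≡ E₂))
    where
    λ′≡ : λ′ ≡ r - μ * (m - 1ℤ)
    λ′≡ = i-j≡0⇒i≡j λ′ _ (trans (λ′-combination r μ λ′ m) (cong -_ (i≡j⇒i-j≡0 r+μ≡)))
      where
      λ′-combination : ∀ r μ λ′ m → λ′ - (r - μ * (m - 1ℤ)) ≡ - ((r + μ) - (λ′ + μ * m))
      λ′-combination = solve-∀
    with-λ′ : ∀ {λ′} → λ′ ≡ r - μ * (m - 1ℤ) → (x + μ * n) * r + λ′ ≡ v * λ′ + r →
      μ * ((m - 1ℤ + n * (b - m)) * (r - m) * (b - m - r) - (μ - 1ℤ) * (m - 1ℤ) * b * n * (b - m)) ≡ 0ℤ
    with-λ′ refl E₂ = trans (combination x r b v m n μ)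
      (vanishes (i≡j⇒i-j≡0 E₃) (i≡j⇒i-j≡0 E₂) (i≡j⇒i-j≡0 E₁) (i≡j⇒i-j≡0 E₄))
      where
      combination : ∀ x r b v m n μ →
        μ * ((m - 1ℤ + n * (b - m)) * (r - m) * (b - m - r) - (μ - 1ℤ) * (m - 1ℤ) * b * n * (b - m)) ≡
        (b - r) * ((r - μ * (m - 1ℤ)) * (b * (x + μ * n) - v * r)
                   - r * ((x + μ * n) * r + (r - μ * (m - 1ℤ)) - (v * (r - μ * (m - 1ℤ)) + r)))
        - ((r - μ * (m - 1ℤ)) * b - r * r) * (b * x + μ * n * m - (x + μ * n) * r)
        - μ * (b - m) * (b * n + m * m - (m * n + 1ℤ) * m)
      combination = solve-∀
      vanishes : ∀ {h₃ h₂ h₁ h₄} → h₃ ≡ 0ℤ → h₂ ≡ 0ℤ → h₁ ≡ 0ℤ → h₄ ≡ 0ℤ →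
        (b - r) * ((r - μ * (m - 1ℤ)) * h₃ - r * h₂) - ((r - μ * (m - 1ℤ)) * b - r * r) * h₁
          - μ * (b - m) * h₄ ≡ 0ℤ
      vanishes refl refl refl refl = zeros b r μ m
        where
        zeros : ∀ b r μ m → (b - r) * ((r - μ * (m - 1ℤ)) * 0ℤ - r * 0ℤ) - ((r - μ * (m - 1ℤ)) * b - r * r) * 0ℤ
                             - μ * (b - m) * 0ℤ ≡ 0ℤ
        zeros = solve-∀

  parameter-identity-μ≡1 : ∀ (m n b r t m₁ : ℤ) → b ≡ m + t → m ≡ 1ℤ + m₁ →
    ParameterIdentity m n b r 1ℤ →
    (m₁ + n * t) * (r - m) * (b - (m + r)) ≡ 0ℤ
  parameter-identity-μ≡1 m n b r t m₁ refl refl key =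
    trans (regroup m₁ t r n) (trans key (zeros m₁ t n))
    where
    regroup : ∀ m₁ t r n → (m₁ + n * t) * (r - (1ℤ + m₁)) * (1ℤ + m₁ + t - (1ℤ + m₁ + r))
      ≡ (1ℤ + m₁ - 1ℤ + n * (1ℤ + m₁ + t - (1ℤ + m₁))) * (r - (1ℤ + m₁)) * (1ℤ + m₁ + t - (1ℤ + m₁) - r)
    regroup = solve-∀
    zeros : ∀ m₁ t n → (1ℤ - 1ℤ) * (1ℤ + m₁ - 1ℤ) * (1ℤ + m₁ + t) * n * (1ℤ + m₁ + t - (1ℤ + m₁)) ≡ 0ℤ
    zeros = solve-∀

  parameter-identity-split : ∀ (m b r μ t m₁ u w n μ₁ : ℤ) →
    m ≡ 1ℤ + m₁ → r ≡ m + u → t ≡ r + w → b ≡ m + t → μ ≡ 1ℤ + μ₁ →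
    ParameterIdentity m n b r μ →
    (m₁ + n * t) * u * w ≡ μ₁ * m₁ * b * n * t
  parameter-identity-split m b r μ t m₁ u w n μ₁ refl refl refl refl refl key =
    trans (regroupˡ m₁ u w n) (trans key (regroupʳ m₁ u w n μ₁))
    where
    regroupˡ : ∀ m₁ u w n → (m₁ + n * (1ℤ + m₁ + u + w)) * u * w ≡
      (1ℤ + m₁ - 1ℤ + n * (1ℤ + m₁ + (1ℤ + m₁ + u + w) - (1ℤ + m₁))) * (1ℤ + m₁ + u - (1ℤ + m₁))
        * (1ℤ + m₁ + (1ℤ + m₁ + u + w) - (1ℤ + m₁) - (1ℤ + m₁ + u))
    regroupˡ = solve-∀
    regroupʳ : ∀ m₁ u w n μ₁ → (1ℤ + μ₁ - 1ℤ) * (1ℤ + m₁ - 1ℤ) * (1ℤ + m₁ + (1ℤ + m₁ + u + w)) * n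
        * (1ℤ + m₁ + (1ℤ + m₁ + u + w) - (1ℤ + m₁))
      ≡ μ₁ * m₁ * (1ℤ + m₁ + (1ℤ + m₁ + u + w)) * n * (1ℤ + m₁ + u + w)
    regroupʳ = solve-∀

  parameter-identity-sign : ∀ (m b r μ m₁ u t s n μ₁ : ℤ) →
    m ≡ 1ℤ + m₁ → r ≡ m + u → b ≡ m + t → μ ≡ 1ℤ + μ₁ → t + s ≡ r →
    ParameterIdentity m n b r μ →
    (m₁ + n * t) * u * s + μ₁ * m₁ * b * n * t ≡ 0ℤ
  parameter-identity-sign m b r μ m₁ u t s n μ₁ refl refl refl refl t+s≡r key =
    trans (combination m₁ u t s n μ₁) (vanishes (i≡j⇒i-j≡0 t+s≡r) (i≡j⇒i-j≡0 key))
    where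
    combination : ∀ m₁ u t s n μ₁ → (m₁ + n * t) * u * s + μ₁ * m₁ * (1ℤ + m₁ + t) * n * t ≡
      (m₁ + n * t) * u * (t + s - (1ℤ + m₁ + u))
      - ((1ℤ + m₁ - 1ℤ + n * (1ℤ + m₁ + t - (1ℤ + m₁))) * (1ℤ + m₁ + u - (1ℤ + m₁)) * (1ℤ + m₁ + t - (1ℤ + m₁) - (1ℤ + m₁ + u))
         - (1ℤ + μ₁ - 1ℤ) * (1ℤ + m₁ - 1ℤ) * (1ℤ + m₁ + t) * n * (1ℤ + m₁ + t - (1ℤ + m₁)))
    combination = solve-∀
    vanishes : ∀ {h₁ h₂} → h₁ ≡ 0ℤ → h₂ ≡ 0ℤ → (m₁ + n * t) * u * h₁ - h₂ ≡ 0ℤ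
    vanishes refl refl = zeros m₁ n t u
      where
      zeros : ∀ m₁ n t u → (m₁ + n * t) * u * 0ℤ - 0ℤ ≡ 0ℤ
      zeros = solve-∀

  λ₁-identity : ∀ (x r b m μ n k u w t : ℤ) →
    k ≡ x + μ * n → b ≡ m + t → t ≡ r + w → r ≡ m + u →
    b * x + μ * n * m ≡ k * r → x * (m + w) ≡ μ * n * u
  λ₁-identity x r b m μ n k u w t refl refl refl refl E₁ =
    i-j≡0⇒i≡j _ _ (trans (combination x m μ n u w) (i≡j⇒i-j≡0 E₁))
    where
    combination : ∀ x m μ n u w → x * (m + w) - μ * n * u ≡
      (m + (m + u + w)) * x + μ * n * m - (x + μ * n) * (m + u)
    combination = solve-∀

  outside-identity : ∀ (z x r b m μ n k v w t : ℤ) →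
    k ≡ x + μ * n → b ≡ m + t → t ≡ r + w →
    z + k + k ≡ v + x → b * k ≡ v * r → b * x + μ * n * m ≡ k * r → z * r ≡ μ * n * w
  outside-identity z x r b m μ n k v w t refl refl refl Z E₃ E₁ =
    i-j≡0⇒i≡j _ _ (trans (combination z x r m μ n v w) (vanishes (i≡j⇒i-j≡0 Z) (i≡j⇒i-j≡0 E₃) (i≡j⇒i-j≡0 E₁)))
    where
    combination : ∀ z x r m μ n v w → z * r - μ * n * w ≡
      r * (z + (x + μ * n) + (x + μ * n) - (v + x)) - ((m + (r + w)) * (x + μ * n) - v * r)
      + ((m + (r + w)) * x + μ * n * m - (x + μ * n) * r)
    combination = solve-∀
    vanishes : ∀ {h₁ h₂ h₃} → h₁ ≡ 0ℤ → h₂ ≡ 0ℤ → h₃ ≡ 0ℤ → r * h₁ - h₂ + h₃ ≡ 0ℤ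
    vanishes refl refl refl = zeros r
      where
      zeros : ∀ r → r * 0ℤ - 0ℤ + 0ℤ ≡ 0ℤ
      zeros = solve-∀

open import Data.Nat
open import Data.Nat.Properties
open import Data.Nat.Tactic.RingSolver using (solve-∀)
open import Algebra.Properties.Semiring.Sum +-*-semiring
  using (sum; sum-syntax; sum-cong-≗; ∑-distrib-+; ∑-comm; *-distribˡ-sum; sum-permute)

∑-const : ∀ {n} c → ∑[ i < n ] c ≡ n * c
∑-const {zero} c = refl
∑-const {suc n} c = cong (c +_) (∑-const {n} c)

∑-mono : ∀ {n} {f g : Fin n → ℕ} → (∀ i → f i ≤ g i) → sum f ≤ sum g
∑-mono {zero} h = z≤n
∑-mono {suc n} h = +-mono-≤ (h zero) (∑-mono (λ i → h (suc i)))

∑-*ˡ : ∀ {n} c (f : Fin n → ℕ) → ∑[ i < n ] (c * f i) ≡ c * sum f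
∑-*ˡ c f = sym (*-distribˡ-sum c f)

∑-*ʳ : ∀ {n} c (f : Fin n → ℕ) → ∑[ i < n ] (f i * c) ≡ sum f * c
∑-*ʳ c f = trans (sum-cong-≗ (λ i → *-comm (f i) c)) (trans (∑-*ˡ c f) (*-comm c (sum f)))

χ : Bool → ℕ
χ true = 1
χ false = 0

χ≤1 : ∀ a → χ a ≤ 1
χ≤1 true = s≤s z≤n
χ≤1 false = z≤n

χ-∧ : ∀ a c → χ (a ∧ c) ≡ χ a * χ c
χ-∧ true c = sym (+-identityʳ (χ c))
χ-∧ false c = refl

χ-idem : ∀ a → χ a * χ a ≡ χ a
χ-idem true = refl
χ-idem false = refl

χ-not-∧-not : ∀ a c → χ (not a ∧ not c) + χ a + χ c ≡ 1 + χ (a ∧ c)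
χ-not-∧-not true true = refl
χ-not-∧-not true false = refl
χ-not-∧-not false true = refl
χ-not-∧-not false false = refl

χ-does-yes : ∀ {P : Set} (P? : Dec P) → P → χ (does P?) ≡ 1
χ-does-yes P? p = cong χ (dec-true P? p)

χ-does-no : ∀ {P : Set} (P? : Dec P) → ¬ P → χ (does P?) ≡ 0
χ-does-no P? ¬p = cong χ (dec-false P? ¬p)

χ-does-⇔ : ∀ {P Q : Set} → (P → Q) → (Q → P) → (P? : Dec P) (Q? : Dec Q) → χ (does P?) ≡ χ (does Q?)
χ-does-⇔ f g (yes p) Q? = sym (χ-does-yes Q? (f p))
χ-does-⇔ f g (no ¬p) Q? = sym (χ-does-no Q? (λ q → ¬p (g q)))

∣∣≡∑χ : ∀ {n} (p : Subset n) → ∣ p ∣ ≡ ∑[ i < n ] χ (lookup p i)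
∣∣≡∑χ [] = refl
∣∣≡∑χ (true ∷ p) = cong suc (∣∣≡∑χ p)
∣∣≡∑χ (false ∷ p) = ∣∣≡∑χ p

δ : ∀ {n} → Fin n → Fin n → ℕ
δ i j = χ (does (i Fin.≟ j))

δ-refl : ∀ {n} (i : Fin n) → δ i i ≡ 1
δ-refl i = χ-does-yes (i Fin.≟ i) refl

δ-≢ : ∀ {n} {i j : Fin n} → i ≢ j → δ i j ≡ 0
δ-≢ {i = i} {j} = χ-does-no (i Fin.≟ j)

δ-sym : ∀ {n} (i j : Fin n) → δ i j ≡ δ j i
δ-sym i j = χ-does-⇔ sym sym (i Fin.≟ j) (j Fin.≟ i)

∑-δ : ∀ {n} (i : Fin n) (f : Fin n → ℕ) → ∑[ j < n ] (δ i j * f j) ≡ f i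
∑-δ {suc n} zero f = begin
  1 * f zero + ∑[ j < n ] (δ zero (suc j) * f (suc j))
    ≡⟨ cong₂ _+_ (*-identityˡ (f zero)) (sum-cong-≗ (λ j → cong (_* f (suc j)) (δ-≢ {i = zero} {suc j} (λ ())))) ⟩
  f zero + ∑[ j < n ] 0
    ≡⟨ cong (f zero +_) (trans (∑-const {n} 0) (*-zeroʳ n)) ⟩
  f zero + 0 ≡⟨ +-identityʳ (f zero) ⟩
  f zero ∎
  where open ≡-Reasoning
∑-δ {suc n} (suc i) f = begin
  δ (suc i) zero * f zero + ∑[ j < n ] (δ (suc i) (suc j) * f (suc j))
    ≡⟨ cong₂ _+_ (cong (_* f zero) (δ-≢ {i = suc i} {zero} (λ ()))) (sum-cong-≗ (λ j → cong (_* f (suc j)) (δ-suc j))) ⟩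
  ∑[ j < n ] (δ i j * f (suc j)) ≡⟨ ∑-δ i (λ j → f (suc j)) ⟩
  f (suc i) ∎
  where
  open ≡-Reasoning
  δ-suc : ∀ j → δ (suc i) (suc j) ≡ δ i j
  δ-suc j = χ-does-⇔ Fin.suc-injective (cong suc) (suc i Fin.≟ suc j) (i Fin.≟ j)

∑-δʳ : ∀ {n} (i : Fin n) (f : Fin n → ℕ) → ∑[ j < n ] (δ j i * f j) ≡ f i
∑-δʳ i f = trans (sum-cong-≗ (λ j → cong (_* f j) (δ-sym j i))) (∑-δ i f)

∑-pair-≤ : ∀ {n} {i j : Fin n} → i ≢ j → (f : Fin n → ℕ) → f i + f j ≤ sum f
∑-pair-≤ {n} {i} {j} i≢j f = subst (_≤ sum f) pair (∑-mono bound)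
  where
  open ≡-Reasoning
  δ+δ≤1 : ∀ t → δ i t + δ j t ≤ 1
  δ+δ≤1 t with i Fin.≟ t | j Fin.≟ t
  ... | yes refl | yes refl = ⊥-elim (i≢j refl)
  ... | yes _ | no _ = ≤-refl
  ... | no _ | yes _ = ≤-refl
  ... | no _ | no _ = z≤n
  bound : ∀ t → (δ i t + δ j t) * f t ≤ f t
  bound t = subst ((δ i t + δ j t) * f t ≤_) (*-identityˡ (f t)) (*-monoˡ-≤ (f t) (δ+δ≤1 t))
  pair : ∑[ t < n ] ((δ i t + δ j t) * f t) ≡ f i + f j
  pair = begin
    ∑[ t < n ] ((δ i t + δ j t) * f t) ≡⟨ sum-cong-≗ (λ t → *-distribʳ-+ (f t) (δ i t) (δ j t)) ⟩
    ∑[ t < n ] (δ i t * f t + δ j t * f t) ≡⟨ ∑-distrib-+ (λ t → δ i t * f t) (λ t → δ j t * f t) ⟩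
    ∑[ t < n ] (δ i t * f t) + ∑[ t < n ] (δ j t * f t) ≡⟨ cong₂ _+_ (∑-δ i f) (∑-δ j f) ⟩
    f i + f j ∎

∑*∑ : ∀ {m n} (f : Fin m → ℕ) (g : Fin n → ℕ) → sum f * sum g ≡ ∑[ p < m ] ∑[ q < n ] (f p * g q)
∑*∑ f g = begin
  sum f * sum g ≡⟨ sym (∑-*ʳ (sum g) f) ⟩
  ∑[ p < _ ] (f p * sum g) ≡⟨ sum-cong-≗ (λ p → sym (∑-*ˡ (f p) g)) ⟩
  ∑[ p < _ ] ∑[ q < _ ] (f p * g q) ∎
  where open ≡-Reasoning

∑∑-distrib-+ : ∀ {m n} (f g : Fin m → Fin n → ℕ) →
  ∑[ p < m ] ∑[ q < n ] (f p q + g p q) ≡ ∑[ p < m ] ∑[ q < n ] f p q + ∑[ p < m ] ∑[ q < n ] g p q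
∑∑-distrib-+ {m} {n} f g = trans (sum-cong-≗ (λ p → ∑-distrib-+ (f p) (g p)))
                                 (∑-distrib-+ (λ p → ∑[ q < n ] f p q) (λ p → ∑[ q < n ] g p q))

∑-not-∧-not : ∀ {n} (α β : Fin n → Bool) →
  ∑[ i < n ] χ (not (α i) ∧ not (β i)) + ∑[ i < n ] χ (α i) + ∑[ i < n ] χ (β i) ≡ n + ∑[ i < n ] χ (α i ∧ β i)
∑-not-∧-not {n} α β = begin
  ∑[ i < n ] χ (not (α i) ∧ not (β i)) + ∑[ i < n ] χ (α i) + ∑[ i < n ] χ (β i)
    ≡⟨ cong (_+ ∑[ i < n ] χ (β i)) (∑-distrib-+ (λ i → χ (not (α i) ∧ not (β i))) (λ i → χ (α i))) ⟨
  ∑[ i < n ] (χ (not (α i) ∧ not (β i)) + χ (α i)) + ∑[ i < n ] χ (β i)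
    ≡⟨ ∑-distrib-+ (λ i → χ (not (α i) ∧ not (β i)) + χ (α i)) (λ i → χ (β i)) ⟨
  ∑[ i < n ] (χ (not (α i) ∧ not (β i)) + χ (α i) + χ (β i))
    ≡⟨ sum-cong-≗ (λ i → χ-not-∧-not (α i) (β i)) ⟩
  ∑[ i < n ] (1 + χ (α i ∧ β i))
    ≡⟨ ∑-distrib-+ (λ _ → 1) (λ i → χ (α i ∧ β i)) ⟩
  ∑[ i < n ] 1 + ∑[ i < n ] χ (α i ∧ β i)
    ≡⟨ cong (_+ ∑[ i < n ] χ (α i ∧ β i)) (trans (∑-const {n} 1) (*-identityʳ n)) ⟩
  n + ∑[ i < n ] χ (α i ∧ β i) ∎
  where open ≡-Reasoning

exchange : ∀ {a c x y l w : ℕ} → a + l ≡ w + x → c + l ≡ w + y → a + y ≡ c + x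
exchange {a} {c} {x} {y} {l} {w} a+l≡w+x c+l≡w+y = +-cancelʳ-≡ l (a + y) (c + x) (begin
  a + y + l   ≡⟨ +-swap a y l ⟩
  a + l + y   ≡⟨ cong (_+ y) a+l≡w+x ⟩
  w + x + y   ≡⟨ +-swap w x y ⟩
  w + y + x   ≡⟨ cong (_+ x) (sym c+l≡w+y) ⟩
  c + l + x   ≡⟨ +-swap c l x ⟩
  c + x + l   ∎)
  where
  open ≡-Reasoning
  +-swap : ∀ a c e → a + c + e ≡ a + e + c
  +-swap = solve-∀

module Incidence (D : Design) where
  open ≡-Reasoning

  incidence : Fin (b D) → Fin (v D) → ℕ
  incidence i p = χ (lookup (blocks D i) p)

  replication : Fin (v D) → ℕ
  replication p = ∑[ i < b D ] incidence i p

  pairCount : Fin (v D) → Fin (v D) → ℕ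
  pairCount p q = ∑[ i < b D ] (incidence i p * incidence i q)

  ∣block∣≡∑ : ∀ i → ∣ blocks D i ∣ ≡ ∑[ p < v D ] incidence i p
  ∣block∣≡∑ i = ∣∣≡∑χ (blocks D i)

  inter≡∑ : ∀ i j → inter D i j ≡ ∑[ p < v D ] (incidence i p * incidence j p)
  inter≡∑ i j = trans (∣∣≡∑χ (blocks D i ∩ blocks D j)) (sum-cong-≗ λ p →
    trans (cong χ (lookup-zipWith _∧_ p (blocks D i) (blocks D j)))
          (χ-∧ (lookup (blocks D i) p) (lookup (blocks D j) p)))

  ∣blocksThrough∣≡pairCount : ∀ p q → ∣ blocksThrough D p q ∣ ≡ pairCount p q
  ∣blocksThrough∣≡pairCount p q = trans (∣∣≡∑χ (blocksThrough D p q)) (sum-cong-≗ λ i →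
    trans (cong χ (lookup∘tabulate (λ i → lookup (blocks D i) p ∧ lookup (blocks D i) q) i))
          (χ-∧ (lookup (blocks D i) p) (lookup (blocks D i) q)))

  pairCount-diag : ∀ p → pairCount p p ≡ replication p
  pairCount-diag p = sum-cong-≗ (λ i → χ-idem (lookup (blocks D i) p))

  inter-sym : ∀ i j → inter D i j ≡ inter D j i
  inter-sym i j = trans (inter≡∑ i j)
    (trans (sum-cong-≗ (λ p → *-comm (incidence i p) (incidence j p))) (sym (inter≡∑ j i)))

  inter-diag : ∀ i → inter D i i ≡ ∣ blocks D i ∣
  inter-diag i = cong ∣_∣ (∩-idem (blocks D i))
    where open import Data.Fin.Subset.Properties using (∩-idem)

  replication≤b : ∀ p → replication p ≤ b D
  replication≤b p = subst (replication p ≤_) (trans (∑-const {b D} 1) (*-identityʳ (b D)))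
    (∑-mono (λ i → χ≤1 (lookup (blocks D i) p)))

  ∣blocksThrough-complement∣ : ∀ p q →
    ∣ blocksThrough (complement D) p q ∣ + replication p + replication q ≡ b D + pairCount p q
  ∣blocksThrough-complement∣ p q = begin
    ∣ blocksThrough (complement D) p q ∣ + replication p + replication q
      ≡⟨ cong (λ x → x + replication p + replication q) (trans (∣∣≡∑χ (blocksThrough (complement D) p q)) (sum-cong-≗ outside-both)) ⟩
    ∑[ i < b D ] χ (not (α i) ∧ not (β i)) + replication p + replication q
      ≡⟨ ∑-not-∧-not α β ⟩
    b D + ∑[ i < b D ] χ (α i ∧ β i)
      ≡⟨ cong (b D +_) (sum-cong-≗ (λ i → χ-∧ (α i) (β i))) ⟩
    b D + pairCount p q ∎
    where
    α β : Fin (b D) → Bool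
    α i = lookup (blocks D i) p
    β i = lookup (blocks D i) q
    outside-both : ∀ i → χ (lookup (blocksThrough (complement D) p q) i) ≡ χ (not (α i) ∧ not (β i))
    outside-both i = cong χ (trans (lookup∘tabulate (λ i → lookup (∁ (blocks D i)) p ∧ lookup (∁ (blocks D i)) q) i)
                                   (cong₂ _∧_ (lookup-map p not (blocks D i)) (lookup-map q not (blocks D i))))

  inter-complement : ∀ i j → inter (complement D) i j + ∣ blocks D i ∣ + ∣ blocks D j ∣ ≡ v D + inter D i j
  inter-complement i j = begin
    inter (complement D) i j + ∣ blocks D i ∣ + ∣ blocks D j ∣
      ≡⟨ cong₃ (trans (∣∣≡∑χ (∁ (blocks D i) ∩ ∁ (blocks D j))) (sum-cong-≗ outside-both)) (∣∣≡∑χ (blocks D i)) (∣∣≡∑χ (blocks D j)) ⟩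
    ∑[ p < v D ] χ (not (α p) ∧ not (β p)) + ∑[ p < v D ] χ (α p) + ∑[ p < v D ] χ (β p)
      ≡⟨ ∑-not-∧-not α β ⟩
    v D + ∑[ p < v D ] χ (α p ∧ β p)
      ≡⟨ cong (v D +_) (trans (sum-cong-≗ (λ p → χ-∧ (α p) (β p))) (sym (inter≡∑ i j))) ⟩
    v D + inter D i j ∎
    where
    α β : Fin (v D) → Bool
    α p = lookup (blocks D i) p
    β p = lookup (blocks D j) p
    cong₃ : ∀ {x x′ y y′ z z′ : ℕ} → x ≡ x′ → y ≡ y′ → z ≡ z′ → x + y + z ≡ x′ + y′ + z′
    cong₃ refl refl refl = refl
    outside-both : ∀ p → χ (lookup (∁ (blocks D i) ∩ ∁ (blocks D j)) p) ≡ χ (not (α p) ∧ not (β p))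
    outside-both p = cong χ (trans (lookup-zipWith _∧_ p (∁ (blocks D i)) (∁ (blocks D j)))
                                   (cong₂ _∧_ (lookup-map p not (blocks D i)) (lookup-map p not (blocks D j))))

  ∑-inter≡∑∑ : ∀ i l → ∑[ j < b D ] (inter D i j * inter D j l)
                     ≡ ∑[ p < v D ] ∑[ q < v D ] (incidence i p * incidence l q * pairCount p q)
  ∑-inter≡∑∑ i l = begin
    ∑[ j < b D ] (inter D i j * inter D j l)
      ≡⟨ sum-cong-≗ (λ j → cong₂ _*_ (inter≡∑ i j) (trans (inter-sym j l) (inter≡∑ l j))) ⟩
    ∑[ j < b D ] (∑[ p < v D ] (incidence i p * incidence j p) * ∑[ q < v D ] (incidence l q * incidence j q))
      ≡⟨ sum-cong-≗ (λ j → ∑*∑ (λ p → incidence i p * incidence j p) (λ q → incidence l q * incidence j q)) ⟩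
    ∑[ j < b D ] ∑[ p < v D ] ∑[ q < v D ] (incidence i p * incidence j p * (incidence l q * incidence j q))
      ≡⟨ ∑-comm (λ j p → ∑[ q < v D ] (incidence i p * incidence j p * (incidence l q * incidence j q))) ⟩
    ∑[ p < v D ] ∑[ j < b D ] ∑[ q < v D ] (incidence i p * incidence j p * (incidence l q * incidence j q))
      ≡⟨ sum-cong-≗ (λ p → ∑-comm (λ j q → incidence i p * incidence j p * (incidence l q * incidence j q))) ⟩
    ∑[ p < v D ] ∑[ q < v D ] ∑[ j < b D ] (incidence i p * incidence j p * (incidence l q * incidence j q))
      ≡⟨ sum-cong-≗ (λ p → sum-cong-≗ (λ q →
           trans (sum-cong-≗ (λ j → regroup (incidence i p) (incidence j p) (incidence l q) (incidence j q)))
                 (∑-*ˡ (incidence i p * incidence l q) (λ j → incidence j p * incidence j q)))) ⟩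
    ∑[ p < v D ] ∑[ q < v D ] (incidence i p * incidence l q * pairCount p q) ∎
    where
    regroup : ∀ a c e f → a * c * (e * f) ≡ a * e * (c * f)
    regroup = solve-∀

  module _ {k λ′ : ℕ} (isDesign : IsDesign D k λ′) where

    ∣block∣≡k : ∀ i → ∣ blocks D i ∣ ≡ k
    ∣block∣≡k = proj₁ (proj₂ (proj₂ isDesign))

    ∑-incidence≡k : ∀ i → ∑[ p < v D ] incidence i p ≡ k
    ∑-incidence≡k i = trans (sym (∣block∣≡∑ i)) (∣block∣≡k i)

    pairCount-δ : ∀ p q → pairCount p q + δ p q * λ′ ≡ λ′ + δ p q * replication p
    pairCount-δ p q with p Fin.≟ q
    ... | yes refl = begin
      pairCount p p + 1 * λ′ ≡⟨ cong₂ _+_ (pairCount-diag p) (*-identityˡ λ′) ⟩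
      replication p + λ′     ≡⟨ +-comm (replication p) λ′ ⟩
      λ′ + replication p     ≡⟨ cong (λ′ +_) (sym (*-identityˡ (replication p))) ⟩
      λ′ + 1 * replication p ∎
    ... | no p≢q = cong (_+ 0) (trans (sym (∣blocksThrough∣≡pairCount p q)) (proj₂ (proj₂ (proj₂ isDesign)) p q p≢q))

    replication-equation : ∀ p → k * replication p + λ′ ≡ v D * λ′ + replication p
    replication-equation p = begin
      k * replication p + λ′
        ≡⟨ cong₂ _+_ k*r≡∑pairCount (sym (∑-δ p (λ _ → λ′))) ⟩
      ∑[ q < v D ] pairCount p q + ∑[ q < v D ] (δ p q * λ′)
        ≡⟨ sym (∑-distrib-+ (pairCount p) (λ q → δ p q * λ′)) ⟩
      ∑[ q < v D ] (pairCount p q + δ p q * λ′)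
        ≡⟨ sum-cong-≗ (pairCount-δ p) ⟩
      ∑[ q < v D ] (λ′ + δ p q * replication p)
        ≡⟨ ∑-distrib-+ (λ _ → λ′) (λ q → δ p q * replication p) ⟩
      ∑[ q < v D ] λ′ + ∑[ q < v D ] (δ p q * replication p)
        ≡⟨ cong₂ _+_ (∑-const {v D} λ′) (∑-δ p (λ _ → replication p)) ⟩
      v D * λ′ + replication p ∎
      where
      k*r≡∑pairCount : k * replication p ≡ ∑[ q < v D ] pairCount p q
      k*r≡∑pairCount = begin
        k * replication p
          ≡⟨ ∑-*ˡ k (λ i → incidence i p) ⟨
        ∑[ i < b D ] (k * incidence i p)
          ≡⟨ sum-cong-≗ (λ i → trans (∑-*ʳ (incidence i p) (incidence i)) (cong (_* incidence i p) (∑-incidence≡k i))) ⟨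
        ∑[ i < b D ] ∑[ q < v D ] (incidence i q * incidence i p)
          ≡⟨ sum-cong-≗ (λ i → sum-cong-≗ (λ q → *-comm (incidence i q) (incidence i p))) ⟩
        ∑[ i < b D ] ∑[ q < v D ] (incidence i p * incidence i q)
          ≡⟨ ∑-comm (λ i q → incidence i p * incidence i q) ⟩
        ∑[ q < v D ] pairCount p q ∎

    replication-constant : 2 ≤ k → ∀ p q → replication p ≡ replication q
    replication-constant (s≤s (s≤s {n = j} _)) p q =
      *-cancelˡ-≡ (replication p) (replication q) (suc j) (+-cancelʳ-≡ (replication p + replication q) _ _ (begin
        suc j * replication p + (replication p + replication q) ≡⟨ peel (replication p) (replication q) ⟩
        k * replication p + replication q
          ≡⟨ exchange {l = λ′} {w = v D * λ′} (replication-equation p) (replication-equation q) ⟩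
        k * replication q + replication p ≡⟨ sym (peel (replication q) (replication p)) ⟩
        suc j * replication q + (replication q + replication p) ≡⟨ cong (suc j * replication q +_) (+-comm (replication q) (replication p)) ⟩
        suc j * replication q + (replication p + replication q) ∎))
      where
      peel′ : ∀ j a c → (1 + j) * a + (a + c) ≡ (2 + j) * a + c
      peel′ = solve-∀
      peel : ∀ a c → suc j * a + (a + c) ≡ suc (suc j) * a + c
      peel = peel′ j

    replication₀ : ℕ
    replication₀ = replication (Data.Fin.fromℕ< (≤-<-trans z≤n (proj₁ isDesign)))

    replication₀-equation : k * replication₀ + λ′ ≡ v D * λ′ + replication₀
    replication₀-equation = replication-equation _

    replication≡replication₀ : 2 ≤ k → ∀ p → replication p ≡ replication₀
    replication≡replication₀ 2≤k p = replication-constant 2≤k p _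

    module _ {r : ℕ} (replication≡r : ∀ p → replication p ≡ r) where

      b*k≡v*r : b D * k ≡ v D * r
      b*k≡v*r = begin
        b D * k                                  ≡⟨ ∑-const {b D} k ⟨
        ∑[ i < b D ] k                           ≡⟨ sum-cong-≗ ∑-incidence≡k ⟨
        ∑[ i < b D ] ∑[ p < v D ] incidence i p  ≡⟨ ∑-comm (λ i p → incidence i p) ⟩
        ∑[ p < v D ] replication p               ≡⟨ sum-cong-≗ replication≡r ⟩
        ∑[ p < v D ] r                           ≡⟨ ∑-const {v D} r ⟩
        v D * r                                  ∎

      ∑-inter≡k*r : ∀ i → ∑[ j < b D ] inter D i j ≡ k * r
      ∑-inter≡k*r i = begin
        ∑[ j < b D ] inter D i j
          ≡⟨ sum-cong-≗ (inter≡∑ i) ⟩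
        ∑[ j < b D ] ∑[ p < v D ] (incidence i p * incidence j p)
          ≡⟨ ∑-comm (λ j p → incidence i p * incidence j p) ⟩
        ∑[ p < v D ] ∑[ j < b D ] (incidence i p * incidence j p)
          ≡⟨ sum-cong-≗ (λ p → trans (∑-*ˡ (incidence i p) (λ j → incidence j p)) (cong (incidence i p *_) (replication≡r p))) ⟩
        ∑[ p < v D ] (incidence i p * r)
          ≡⟨ ∑-*ʳ r (incidence i) ⟩
        ∑[ p < v D ] incidence i p * r
          ≡⟨ cong (_* r) (∑-incidence≡k i) ⟩
        k * r ∎

      ∑-inter² : ∀ i l → ∑[ j < b D ] (inter D i j * inter D j l) + λ′ * inter D i l
                       ≡ λ′ * (k * k) + r * inter D i l
      ∑-inter² i l = begin
        ∑[ j < b D ] (inter D i j * inter D j l) + λ′ * inter D i l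
          ≡⟨ cong₂ _+_ (∑-inter≡∑∑ i l) λ′-term ⟩
        ∑[ p < v D ] ∑[ q < v D ] (A p q * pairCount p q) + ∑[ p < v D ] ∑[ q < v D ] (A p q * (δ p q * λ′))
          ≡⟨ sym (∑∑-distrib-+ (λ p q → A p q * pairCount p q) (λ p q → A p q * (δ p q * λ′))) ⟩
        ∑[ p < v D ] ∑[ q < v D ] (A p q * pairCount p q + A p q * (δ p q * λ′))
          ≡⟨ sum-cong-≗ (λ p → sum-cong-≗ (λ q → use-pairCount-δ p q)) ⟩
        ∑[ p < v D ] ∑[ q < v D ] (A p q * λ′ + A p q * (δ p q * r))
          ≡⟨ ∑∑-distrib-+ (λ p q → A p q * λ′) (λ p q → A p q * (δ p q * r)) ⟩
        ∑[ p < v D ] ∑[ q < v D ] (A p q * λ′) + ∑[ p < v D ] ∑[ q < v D ] (A p q * (δ p q * r))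
          ≡⟨ cong₂ _+_ λ′-k²-term r-term ⟩
        λ′ * (k * k) + r * inter D i l ∎
        where
        A : Fin (v D) → Fin (v D) → ℕ
        A p q = incidence i p * incidence l q
        use-pairCount-δ : ∀ p q → A p q * pairCount p q + A p q * (δ p q * λ′) ≡ A p q * λ′ + A p q * (δ p q * r)
        use-pairCount-δ p q = begin
          A p q * pairCount p q + A p q * (δ p q * λ′) ≡⟨ *-distribˡ-+ (A p q) (pairCount p q) (δ p q * λ′) ⟨
          A p q * (pairCount p q + δ p q * λ′)        ≡⟨ cong (A p q *_) (pairCount-δ p q) ⟩
          A p q * (λ′ + δ p q * replication p)        ≡⟨ cong (λ x → A p q * (λ′ + δ p q * x)) (replication≡r p) ⟩
          A p q * (λ′ + δ p q * r)                    ≡⟨ *-distribˡ-+ (A p q) λ′ (δ p q * r) ⟩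
          A p q * λ′ + A p q * (δ p q * r)            ∎
        diagonal : ∀ c → ∑[ p < v D ] ∑[ q < v D ] (A p q * (δ p q * c)) ≡ c * inter D i l
        diagonal c = begin
          ∑[ p < v D ] ∑[ q < v D ] (A p q * (δ p q * c))
            ≡⟨ sum-cong-≗ (λ p → trans (sum-cong-≗ (λ q → regroup (incidence i p) (incidence l q) (δ p q) c))
                                      (∑-δ p (λ q → c * (incidence i p * incidence l q)))) ⟩
          ∑[ p < v D ] (c * (incidence i p * incidence l p)) ≡⟨ ∑-*ˡ c (λ p → incidence i p * incidence l p) ⟩
          c * ∑[ p < v D ] (incidence i p * incidence l p)   ≡⟨ cong (c *_) (inter≡∑ i l) ⟨
          c * inter D i l ∎
          where
          regroup : ∀ a e d c → a * e * (d * c) ≡ d * (c * (a * e))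
          regroup = solve-∀
        λ′-term : λ′ * inter D i l ≡ ∑[ p < v D ] ∑[ q < v D ] (A p q * (δ p q * λ′))
        λ′-term = sym (diagonal λ′)
        r-term : ∑[ p < v D ] ∑[ q < v D ] (A p q * (δ p q * r)) ≡ r * inter D i l
        r-term = diagonal r
        λ′-k²-term : ∑[ p < v D ] ∑[ q < v D ] (A p q * λ′) ≡ λ′ * (k * k)
        λ′-k²-term = begin
          ∑[ p < v D ] ∑[ q < v D ] (A p q * λ′)
            ≡⟨ sum-cong-≗ (λ p → trans (∑-*ʳ λ′ (A p)) (cong (_* λ′) (trans (∑-*ˡ (incidence i p) (incidence l)) (cong (incidence i p *_) (∑-incidence≡k l))))) ⟩
          ∑[ p < v D ] (incidence i p * k * λ′)
            ≡⟨ trans (sum-cong-≗ (λ p → regroup (incidence i p) k λ′)) (∑-*ˡ (λ′ * k) (incidence i)) ⟩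
          λ′ * k * ∑[ p < v D ] incidence i p
            ≡⟨ trans (cong (λ′ * k *_) (∑-incidence≡k i)) (*-assoc λ′ k k) ⟩
          λ′ * (k * k) ∎
          where
          regroup : ∀ a k c → a * k * c ≡ c * k * a
          regroup = solve-∀

      complement-isDesign : ∀ {λc} → 1 ≤ k → 1 ≤ λc → λc + r + r ≡ b D + λ′ → IsDesign (complement D) (v D ∸ k) λc
      complement-isDesign {λc} 1≤k 1≤λc balance = ∸-monoʳ-< {v D} {k} {0} 1≤k (<⇒≤ (proj₁ isDesign)) , 1≤λc , size , through
        where
        size : ∀ i → ∣ ∁ (blocks D i) ∣ ≡ v D ∸ k
        size i = trans (∣∁p∣≡n∸∣p∣ (blocks D i)) (cong (v D ∸_) (∣block∣≡k i))
          where open import Data.Fin.Subset.Properties using (∣∁p∣≡n∸∣p∣)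
        through : ∀ p q → p ≢ q → ∣ blocksThrough (complement D) p q ∣ ≡ λc
        through p q p≢q = +-cancelʳ-≡ (r + r) _ _ (begin
          ∣ blocksThrough (complement D) p q ∣ + (r + r)
            ≡⟨ sym (+-assoc _ r r) ⟩
          ∣ blocksThrough (complement D) p q ∣ + r + r
            ≡⟨ cong₂ (λ x y → ∣ blocksThrough (complement D) p q ∣ + x + y) (sym (replication≡r p)) (sym (replication≡r q)) ⟩
          ∣ blocksThrough (complement D) p q ∣ + replication p + replication q
            ≡⟨ ∣blocksThrough-complement∣ p q ⟩
          b D + pairCount p q
            ≡⟨ cong (b D +_) (trans (sym (∣blocksThrough∣≡pairCount p q)) (proj₂ (proj₂ (proj₂ isDesign)) p q p≢q)) ⟩
          b D + λ′
            ≡⟨ sym balance ⟩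
          λc + r + r
            ≡⟨ +-assoc λc r r ⟩
          λc + (r + r) ∎)

∑-square-shift : ∀ {b} (N : Fin b → Fin b → ℕ) (K : ℕ) (i l : Fin b) →
  ∑[ j < b ] ((N i j + δ i j * K) * (N j l + δ j l * K))
    ≡ ∑[ j < b ] (N i j * N j l) + K * N i l + K * N i l + δ i l * (K * K)
∑-square-shift {b} N K i l = begin
  ∑[ j < b ] ((N i j + δ i j * K) * (N j l + δ j l * K))
    ≡⟨ sum-cong-≗ (λ j → expand K (N i j) (N j l) (δ i j) (δ j l)) ⟩
  ∑[ j < b ] (N i j * N j l + δ i j * (K * N j l) + δ j l * (K * N i j) + δ i j * (δ j l * (K * K)))
    ≡⟨ ∑-distrib-+ (λ j → N i j * N j l + δ i j * (K * N j l) + δ j l * (K * N i j)) (λ j → δ i j * (δ j l * (K * K))) ⟩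
  ∑[ j < b ] (N i j * N j l + δ i j * (K * N j l) + δ j l * (K * N i j)) + ∑[ j < b ] (δ i j * (δ j l * (K * K)))
    ≡⟨ cong₂ _+_ (∑-distrib-+ (λ j → N i j * N j l + δ i j * (K * N j l)) (λ j → δ j l * (K * N i j))) (∑-δ i (λ j → δ j l * (K * K))) ⟩
  ∑[ j < b ] (N i j * N j l + δ i j * (K * N j l)) + ∑[ j < b ] (δ j l * (K * N i j)) + δ i l * (K * K)
    ≡⟨ cong₂ (λ x y → x + y + δ i l * (K * K))
         (trans (∑-distrib-+ (λ j → N i j * N j l) (λ j → δ i j * (K * N j l))) (cong (∑[ j < b ] (N i j * N j l) +_) (∑-δ i (λ j → K * N j l))))
         (∑-δʳ l (λ j → K * N i j)) ⟩
  ∑[ j < b ] (N i j * N j l) + K * N i l + K * N i l + δ i l * (K * K) ∎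
  where
  open ≡-Reasoning
  expand : ∀ K p q e f → (p + e * K) * (q + f * K) ≡ p * q + e * (K * q) + f * (K * p) + e * (f * (K * K))
  expand = solve-∀

-- The (i, l) entry of (NᵀN)² + λ NᵀN = λk²J + r NᵀN when NᵀN = xJ + μA + KI, the rows of A have
-- d ones, (A²)ᵢₗ = c, Aᵢₗ = α and Iᵢₗ = ε.
PairEquation : (b x μ K λ′ k r d c α ε : ℕ) → Set
PairEquation b x μ K λ′ k r d c α ε =
  b * (x * x) + x * μ * d + x * μ * d + μ * μ * c + K * (x + μ * α) + K * (x + μ * α) + ε * (K * K)
    + λ′ * (x + μ * α + ε * K) ≡ λ′ * (k * k) + r * (x + μ * α + ε * K)

module TwoClassMatrix {b : ℕ} (M a : Fin b → Fin b → ℕ) (x μ K : ℕ)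
  (M≡ : ∀ i j → M i j ≡ x + μ * a i j + δ i j * K) (a-sym : ∀ i j → a i j ≡ a j i) where
  open ≡-Reasoning

  degree : Fin b → ℕ
  degree i = ∑[ j < b ] a i j

  common : Fin b → Fin b → ℕ
  common i l = ∑[ j < b ] (a i j * a j l)

  ∑-row : ∀ i → ∑[ j < b ] M i j ≡ b * x + μ * degree i + K
  ∑-row i = begin
    ∑[ j < b ] M i j                                 ≡⟨ sum-cong-≗ (M≡ i) ⟩
    ∑[ j < b ] (x + μ * a i j + δ i j * K)           ≡⟨ ∑-distrib-+ (λ j → x + μ * a i j) (λ j → δ i j * K) ⟩
    ∑[ j < b ] (x + μ * a i j) + ∑[ j < b ] (δ i j * K) ≡⟨ cong₂ _+_ (∑-distrib-+ (λ _ → x) (λ j → μ * a i j)) (∑-δ i (λ _ → K)) ⟩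
    ∑[ j < b ] x + ∑[ j < b ] (μ * a i j) + K       ≡⟨ cong₂ (λ y z → y + z + K) (∑-const {b} x) (∑-*ˡ μ (a i)) ⟩
    b * x + μ * degree i + K                         ∎

  ∑-square : ∀ i l → ∑[ j < b ] (M i j * M j l)
    ≡ b * (x * x) + x * μ * degree l + x * μ * degree i + μ * μ * common i l
      + K * (x + μ * a i l) + K * (x + μ * a i l) + δ i l * (K * K)
  ∑-square i l = begin
    ∑[ j < b ] (M i j * M j l)
      ≡⟨ sum-cong-≗ (λ j → cong₂ _*_ (M≡ i j) (M≡ j l)) ⟩
    ∑[ j < b ] ((L i j + δ i j * K) * (L j l + δ j l * K))
      ≡⟨ ∑-square-shift L K i l ⟩
    ∑[ j < b ] (L i j * L j l) + K * L i l + K * L i l + δ i l * (K * K)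
      ≡⟨ cong (λ y → y + K * L i l + K * L i l + δ i l * (K * K)) ∑-N² ⟩
    b * (x * x) + x * μ * degree l + x * μ * degree i + μ * μ * common i l
      + K * (x + μ * a i l) + K * (x + μ * a i l) + δ i l * (K * K) ∎
    where
    L : Fin b → Fin b → ℕ
    L i j = x + μ * a i j
    expand : ∀ x μ p q → (x + μ * p) * (x + μ * q) ≡ x * x + x * μ * q + x * μ * p + μ * μ * (p * q)
    expand = solve-∀
    ∑-N² : ∑[ j < b ] (L i j * L j l) ≡ b * (x * x) + x * μ * degree l + x * μ * degree i + μ * μ * common i l
    ∑-N² = begin
      ∑[ j < b ] (L i j * L j l)
        ≡⟨ sum-cong-≗ (λ j → expand x μ (a i j) (a j l)) ⟩
      ∑[ j < b ] (x * x + x * μ * a j l + x * μ * a i j + μ * μ * (a i j * a j l))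
        ≡⟨ ∑-distrib-+ (λ j → x * x + x * μ * a j l + x * μ * a i j) (λ j → μ * μ * (a i j * a j l)) ⟩
      ∑[ j < b ] (x * x + x * μ * a j l + x * μ * a i j) + ∑[ j < b ] (μ * μ * (a i j * a j l))
        ≡⟨ cong₂ _+_ (∑-distrib-+ (λ j → x * x + x * μ * a j l) (λ j → x * μ * a i j)) (∑-*ˡ (μ * μ) (λ j → a i j * a j l)) ⟩
      ∑[ j < b ] (x * x + x * μ * a j l) + ∑[ j < b ] (x * μ * a i j) + μ * μ * common i l
        ≡⟨ cong₂ (λ y z → y + z + μ * μ * common i l) (∑-distrib-+ (λ _ → x * x) (λ j → x * μ * a j l)) (∑-*ˡ (x * μ) (a i)) ⟩
      ∑[ j < b ] (x * x) + ∑[ j < b ] (x * μ * a j l) + x * μ * degree i + μ * μ * common i l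
        ≡⟨ cong₂ (λ y z → y + z + x * μ * degree i + μ * μ * common i l) (∑-const {b} (x * x))
                 (trans (∑-*ˡ (x * μ) (λ j → a j l)) (cong (x * μ *_) (sum-cong-≗ (λ j → a-sym j l)))) ⟩
      b * (x * x) + x * μ * degree l + x * μ * degree i + μ * μ * common i l ∎

  pair-equation : ∀ {λ′ k r d₀} →
    (∀ i l → ∑[ j < b ] (M i j * M j l) + λ′ * M i l ≡ λ′ * (k * k) + r * M i l) →
    (∀ i → degree i ≡ d₀) →
    ∀ {i l α ε} → a i l ≡ α → δ i l ≡ ε → PairEquation b x μ K λ′ k r d₀ (common i l) α ε
  pair-equation {λ′} {k} {r} {d₀} square degree≡d₀ {i} {l} refl refl = begin
    b * (x * x) + x * μ * d₀ + x * μ * d₀ + μ * μ * common i l + K * (x + μ * a i l) + K * (x + μ * a i l)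
      + δ i l * (K * K) + λ′ * (x + μ * a i l + δ i l * K)
      ≡⟨ cong (λ w → b * (x * x) + x * μ * d₀ + x * μ * d₀ + μ * μ * common i l + K * (x + μ * a i l)
                    + K * (x + μ * a i l) + δ i l * (K * K) + λ′ * w) (M≡ i l) ⟨
    b * (x * x) + x * μ * d₀ + x * μ * d₀ + μ * μ * common i l + K * (x + μ * a i l) + K * (x + μ * a i l)
      + δ i l * (K * K) + λ′ * M i l
      ≡⟨ cong₂ (λ y z → b * (x * x) + x * μ * y + x * μ * z + μ * μ * common i l + K * (x + μ * a i l) + K * (x + μ * a i l)
                       + δ i l * (K * K) + λ′ * M i l) (sym (degree≡d₀ l)) (sym (degree≡d₀ i)) ⟩
    b * (x * x) + x * μ * degree l + x * μ * degree i + μ * μ * common i l + K * (x + μ * a i l) + K * (x + μ * a i l)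
      + δ i l * (K * K) + λ′ * M i l
      ≡⟨ cong (_+ λ′ * M i l) (∑-square i l) ⟨
    ∑[ j < b ] (M i j * M j l) + λ′ * M i l
      ≡⟨ square i l ⟩
    λ′ * (k * k) + r * M i l
      ≡⟨ cong (λ w → λ′ * (k * k) + r * w) (M≡ i l) ⟩
    λ′ * (k * k) + r * (x + μ * a i l + δ i l * K) ∎

adjacency : (G : Graph) → (∀ i j → Dec (Adj G i j)) → Fin (N G) → Fin (N G) → ℕ
adjacency G adj? i j = χ (does (adj? i j))

module _ {G H : Graph} (adjG? : ∀ i j → Dec (Adj G i j)) (adjH? : ∀ i j → Dec (Adj H i j))
         (G≅H : G ≅G H) where

  private
    f : Fin (N G) ↔ Fin (N H)
    f = proj₁ G≅H
    aG : Fin (N G) → Fin (N G) → ℕ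
    aG = adjacency G adjG?
    aH : Fin (N H) → Fin (N H) → ℕ
    aH = adjacency H adjH?

  adjacency-≅ : ∀ i j → aG i j ≡ aH (Inverse.to f i) (Inverse.to f j)
  adjacency-≅ i j = χ-does-⇔ (Equivalence.to (proj₂ G≅H i j)) (Equivalence.from (proj₂ G≅H i j))
                              (adjG? i j) (adjH? (Inverse.to f i) (Inverse.to f j))

  degree-≅ : ∀ i → ∑[ j < N G ] aG i j ≡ ∑[ j < N H ] aH (Inverse.to f i) j
  degree-≅ i = trans (sum-cong-≗ (λ j → adjacency-≅ i j)) (sym (sum-permute (aH (Inverse.to f i)) f))

  common-≅ : ∀ i l → ∑[ j < N G ] (aG i j * aG j l) ≡ ∑[ j < N H ] (aH (Inverse.to f i) j * aH j (Inverse.to f l))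
  common-≅ i l = trans (sum-cong-≗ (λ j → cong₂ _*_ (adjacency-≅ i j) (adjacency-≅ j l)))
                       (sym (sum-permute (λ j → aH (Inverse.to f i) j * aH j (Inverse.to f l)) f))

module SteinerBlockGraph (E : Design) {k : ℕ} (isSteiner : IsDesign E k 1) (2≤k : 2 ≤ k) where
  open ≡-Reasoning
  open Incidence E

  r : ℕ
  r = replication₀ isSteiner

  replication≡r : ∀ p → replication p ≡ r
  replication≡r = replication≡replication₀ isSteiner 2≤k

  private
    square : ∀ i l → ∑[ j < b E ] (inter E i j * inter E j l) + 1 * inter E i l ≡ 1 * (k * k) + r * inter E i l
    square = ∑-inter² isSteiner replication≡r

  inter-diag≡k : ∀ i → inter E i i ≡ k
  inter-diag≡k i = trans (inter-diag i) (∣block∣≡k isSteiner i)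

  inter≤1 : ∀ i j → i ≢ j → inter E i j ≤ 1
  inter≤1 i j i≢j = a[a∸1]≡0⇒a≤1 (inter E i j) (n≤0⇒n≡0 (+-cancelˡ-≤ (g i) (g j) 0
                       (subst (g i + g j ≤_) (trans ∑g≡g[i] (sym (+-identityʳ (g i)))) (∑-pair-≤ i≢j g))))
    where
    a[a∸1]≡0⇒a≤1 : ∀ a → a * (a ∸ 1) ≡ 0 → a ≤ 1
    a[a∸1]≡0⇒a≤1 zero _ = z≤n
    a[a∸1]≡0⇒a≤1 (suc zero) _ = s≤s z≤n
    a[a∸1]≡0⇒a≤1 (suc (suc a)) ()
    a[a∸1]+a≡a² : ∀ a → a * (a ∸ 1) + a ≡ a * a
    a[a∸1]+a≡a² zero = refl
    a[a∸1]+a≡a² (suc a) = sq a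
      where
      sq : ∀ a → (1 + a) * a + (1 + a) ≡ (1 + a) * (1 + a)
      sq = solve-∀
    g : Fin (b E) → ℕ
    g t = inter E i t * (inter E i t ∸ 1)
    -- ∑ₜ |Bᵢ ∩ Bₜ|² = k² + (r − 1)k and ∑ₜ |Bᵢ ∩ Bₜ| = kr, so the nonnegative terms g t add up to g i alone.
    ∑g+k≡g[i]+k : sum g + k ≡ g i + k
    ∑g+k≡g[i]+k = +-cancelʳ-≡ (k * r) _ _ (begin
      sum g + k + k * r
        ≡⟨ +-swap (sum g) k (k * r) ⟩
      sum g + k * r + k
        ≡⟨ cong (λ y → sum g + y + k) (∑-inter≡k*r isSteiner replication≡r i) ⟨
      sum g + ∑[ t < b E ] inter E i t + k
        ≡⟨ cong (_+ k) (trans (sym (∑-distrib-+ g (inter E i))) (sum-cong-≗ (λ t → a[a∸1]+a≡a² (inter E i t)))) ⟩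
      ∑[ t < b E ] (inter E i t * inter E i t) + k
        ≡⟨ cong₂ (λ y z → y + z) (sum-cong-≗ (λ t → cong (inter E i t *_) (inter-sym i t))) (sym (+-identityʳ k)) ⟩
      ∑[ t < b E ] (inter E i t * inter E t i) + 1 * k
        ≡⟨ cong (λ y → ∑[ t < b E ] (inter E i t * inter E t i) + 1 * y) (inter-diag≡k i) ⟨
      ∑[ t < b E ] (inter E i t * inter E t i) + 1 * inter E i i
        ≡⟨ square i i ⟩
      1 * (k * k) + r * inter E i i
        ≡⟨ cong (λ y → 1 * (k * k) + r * y) (inter-diag≡k i) ⟩
      1 * (k * k) + r * k
        ≡⟨ cong₂ _+_ (*-identityˡ (k * k)) (*-comm r k) ⟩
      k * k + k * r
        ≡⟨ cong (_+ k * r) (a[a∸1]+a≡a² k) ⟨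
      k * (k ∸ 1) + k + k * r
        ≡⟨ cong (λ y → y * (y ∸ 1) + k + k * r) (inter-diag≡k i) ⟨
      g i + k + k * r ∎)
      where
      +-swap : ∀ a c e → a + c + e ≡ a + e + c
      +-swap = solve-∀
    ∑g≡g[i] : sum g ≡ g i
    ∑g≡g[i] = +-cancelʳ-≡ k _ _ ∑g+k≡g[i]+k

  adjacent? : ∀ i j → Dec (Adj (steinerBlockGraph E) i j)
  adjacent? i j = ¬? (i Fin.≟ j) ×-dec (1 ≤? inter E i j)

  a : Fin (b E) → Fin (b E) → ℕ
  a = adjacency (steinerBlockGraph E) adjacent?

  a-sym : ∀ i j → a i j ≡ a j i
  a-sym i j = χ-does-⇔ flip flip (adjacent? i j) (adjacent? j i)
    where
    flip : ∀ {i j} → Adj (steinerBlockGraph E) i j → Adj (steinerBlockGraph E) j i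
    flip {i} {j} (i≢j , 1≤ij) = (λ j≡i → i≢j (sym j≡i)) , subst (1 ≤_) (inter-sym i j) 1≤ij

  inter≡a+δk : ∀ i j → inter E i j ≡ 0 + 1 * a i j + δ i j * k
  inter≡a+δk i j with toSum (i Fin.≟ j)
  ... | inj₁ refl = begin
    inter E i i             ≡⟨ inter-diag≡k i ⟩
    k                       ≡⟨ +-identityʳ k ⟨
    1 * k                   ≡⟨ cong₂ (λ y z → y + z * k) (trans (+-identityʳ (a i i)) (χ-does-no (adjacent? i i) (λ adj → proj₁ adj refl))) (δ-refl i) ⟨
    1 * a i i + δ i i * k   ∎
  ... | inj₂ i≢j with 1 ≤? inter E i j
  ...   | yes 1≤ij = begin
    inter E i j             ≡⟨ ≤-antisym (inter≤1 i j i≢j) 1≤ij ⟩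
    1                       ≡⟨ trans (+-identityʳ (a i j)) (χ-does-yes (adjacent? i j) (i≢j , 1≤ij)) ⟨
    1 * a i j               ≡⟨ +-identityʳ (1 * a i j) ⟨
    1 * a i j + 0 * k       ≡⟨ cong (λ z → 1 * a i j + z * k) (δ-≢ i≢j) ⟨
    1 * a i j + δ i j * k   ∎
  ...   | no ¬1≤ij = begin
    inter E i j             ≡⟨ n<1⇒n≡0 (≰⇒> ¬1≤ij) ⟩
    0                       ≡⟨ cong₂ (λ y z → y + z * k) (trans (+-identityʳ (a i j)) (χ-does-no (adjacent? i j) (λ adj → ¬1≤ij (proj₂ adj)))) (δ-≢ i≢j) ⟨
    1 * a i j + δ i j * k   ∎

  open TwoClassMatrix (inter E) a 0 1 k inter≡a+δk a-sym public

  degree+k≡k*r : ∀ i → degree i + k ≡ k * r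
  degree+k≡k*r i = begin
    degree i + k                 ≡⟨ cong (_+ k) (+-identityʳ (degree i)) ⟨
    1 * degree i + k             ≡⟨ cong (λ y → y + 1 * degree i + k) (*-zeroʳ (b E)) ⟨
    b E * 0 + 1 * degree i + k   ≡⟨ ∑-row i ⟨
    ∑[ j < b E ] inter E i j     ≡⟨ ∑-inter≡k*r isSteiner replication≡r i ⟩
    k * r                        ∎

  degree≡k*r∸k : ∀ i → degree i ≡ k * r ∸ k
  degree≡k*r∸k i = trans (sym (m+n∸n≡m (degree i) k)) (cong (_∸ k) (degree+k≡k*r i))

  common-diag : ∀ i → common i i + k ≡ r * k
  common-diag i = +-cancelˡ-≡ (k * k) _ _ (begin
    k * k + (common i i + k) ≡⟨ diag-lhs (b E) (k * r ∸ k) (common i i) k ⟩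
    _                        ≡⟨ pair-equation {1} {k} {r} square degree≡k*r∸k {i} {i} (χ-does-no (adjacent? i i) (λ adj → proj₁ adj refl)) (δ-refl i) ⟩
    _                        ≡⟨ diag-rhs k r ⟩
    k * k + r * k            ∎)
    where
    diag-lhs : ∀ b d c k → k * k + (c + k) ≡ b * (0 * 0) + 0 * 1 * d + 0 * 1 * d + 1 * 1 * c + k * (0 + 1 * 0)
                                              + k * (0 + 1 * 0) + 1 * (k * k) + 1 * (0 + 1 * 0 + 1 * k)
    diag-lhs = solve-∀
    diag-rhs : ∀ k r → 1 * (k * k) + r * (0 + 1 * 0 + 1 * k) ≡ k * k + r * k
    diag-rhs = solve-∀

  common-adjacent : ∀ i l → a i l ≡ 1 → common i l + k + k + 1 ≡ k * k + r
  common-adjacent i l a≡1 = begin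
    common i l + k + k + 1 ≡⟨ adj-lhs (b E) (k * r ∸ k) (common i l) k ⟩
    _                      ≡⟨ pair-equation {1} {k} {r} square degree≡k*r∸k {i} {l} a≡1 (δ-≢ i≢l) ⟩
    _                      ≡⟨ adj-rhs k r ⟩
    k * k + r              ∎
    where
    i≢l : i ≢ l
    i≢l refl = 0≢1+n (trans (sym (χ-does-no (adjacent? i i) (λ adj → proj₁ adj refl))) a≡1)
    adj-lhs : ∀ b d c k → c + k + k + 1 ≡ b * (0 * 0) + 0 * 1 * d + 0 * 1 * d + 1 * 1 * c + k * (0 + 1 * 1)
                                          + k * (0 + 1 * 1) + 0 * (k * k) + 1 * (0 + 1 * 1 + 0 * k)
    adj-lhs = solve-∀
    adj-rhs : ∀ k r → 1 * (k * k) + r * (0 + 1 * 1 + 0 * k) ≡ k * k + r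
    adj-rhs = solve-∀

  common-nonadjacent : ∀ i l → i ≢ l → a i l ≡ 0 → common i l ≡ k * k
  common-nonadjacent i l i≢l a≡0 = begin
    common i l ≡⟨ non-lhs (b E) (k * r ∸ k) (common i l) k ⟩
    _          ≡⟨ pair-equation {1} {k} {r} square degree≡k*r∸k {i} {l} a≡0 (δ-≢ i≢l) ⟩
    _          ≡⟨ non-rhs k r ⟩
    k * k      ∎
    where
    non-lhs : ∀ b d c k → c ≡ b * (0 * 0) + 0 * 1 * d + 0 * 1 * d + 1 * 1 * c + k * (0 + 1 * 0)
                            + k * (0 + 1 * 0) + 0 * (k * k) + 1 * (0 + 1 * 0 + 0 * k)
    non-lhs = solve-∀
    non-rhs : ∀ k r → 1 * (k * k) + r * (0 + 1 * 0 + 0 * k) ≡ k * k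
    non-rhs = solve-∀

replication-equation⇒2≤k : ∀ {k λ′ v r} → 1 ≤ k → k < v → 1 ≤ λ′ → k * r + λ′ ≡ v * λ′ + r → 2 ≤ k
replication-equation⇒2≤k {suc (suc k)} _ _ _ _ = s≤s (s≤s z≤n)
replication-equation⇒2≤k {suc zero} {λ′@(suc _)} {v} {r} _ 1<v _ eq = contradiction v≡1 (>⇒≢ 1<v)
  where
  λ′≡vλ′ : λ′ ≡ v * λ′
  λ′≡vλ′ = +-cancelʳ-≡ r λ′ (v * λ′) (trans (+-comm λ′ r) (trans (cong (_+ λ′) (sym (*-identityˡ r))) eq))
  v≡1 : v ≡ 1
  v≡1 = sym (*-cancelʳ-≡ 1 v λ′ (trans (*-identityˡ λ′) λ′≡vλ′))

module QuasiSymmetric (D : Design) {λ₁ λ₂ μ : ℕ} (qs : IsQuasiSymmetric D λ₁ λ₂) (λ₂≡λ₁+μ : λ₂ ≡ λ₁ + μ) where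
  open ≡-Reasoning
  open Incidence D

  k λ′ : ℕ
  k = proj₁ (proj₁ qs)
  λ′ = proj₁ (proj₂ (proj₁ qs))

  isDesign : IsDesign D k λ′
  isDesign = proj₂ (proj₂ (proj₁ qs))

  λ₁<λ₂ : λ₁ < λ₂
  λ₁<λ₂ = proj₁ (proj₂ qs)

  i₁ j₁ i₂ j₂ : Fin (b D)
  i₁ = proj₁ (proj₁ (proj₂ (proj₂ (proj₂ qs))))
  j₁ = proj₁ (proj₂ (proj₁ (proj₂ (proj₂ (proj₂ qs)))))
  i₂ = proj₁ (proj₂ (proj₂ (proj₂ (proj₂ qs))))
  j₂ = proj₁ (proj₂ (proj₂ (proj₂ (proj₂ (proj₂ qs)))))

  i₁≢j₁ : i₁ ≢ j₁
  i₁≢j₁ = proj₁ (proj₂ (proj₂ (proj₁ (proj₂ (proj₂ (proj₂ qs))))))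
  inter₁ : inter D i₁ j₁ ≡ λ₁
  inter₁ = proj₂ (proj₂ (proj₂ (proj₁ (proj₂ (proj₂ (proj₂ qs))))))
  i₂≢j₂ : i₂ ≢ j₂
  i₂≢j₂ = proj₁ (proj₂ (proj₂ (proj₂ (proj₂ (proj₂ (proj₂ qs))))))
  inter₂ : inter D i₂ j₂ ≡ λ₂
  inter₂ = proj₂ (proj₂ (proj₂ (proj₂ (proj₂ (proj₂ (proj₂ qs))))))

  λ₂≤k : λ₂ ≤ k
  λ₂≤k = subst₂ _≤_ inter₂ (∣block∣≡k isDesign i₂) (∣p∩q∣≤∣p∣ (blocks D i₂) (blocks D j₂))
    where open import Data.Fin.Subset.Properties using (∣p∩q∣≤∣p∣)

  λ₁≤k : λ₁ ≤ k
  λ₁≤k = ≤-trans (<⇒≤ λ₁<λ₂) λ₂≤k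

  1≤μ : 1 ≤ μ
  1≤μ = +-cancelˡ-≤ λ₁ 1 μ (subst₂ _≤_ (+-comm 1 λ₁) λ₂≡λ₁+μ λ₁<λ₂)

  2≤k : 2 ≤ k
  2≤k = replication-equation⇒2≤k (≤-trans (s≤s z≤n) (≤-trans λ₁<λ₂ λ₂≤k)) (proj₁ isDesign) (proj₁ (proj₂ isDesign))
          (replication₀-equation isDesign)

  r : ℕ
  r = replication₀ isDesign

  replication≡r : ∀ p → replication p ≡ r
  replication≡r = replication≡replication₀ isDesign 2≤k

  K : ℕ
  K = k ∸ λ₁

  k≡λ₁+K : k ≡ λ₁ + K
  k≡λ₁+K = sym (m+[n∸m]≡n λ₁≤k)

  μ≤K : μ ≤ K
  μ≤K = +-cancelˡ-≤ λ₁ μ K (subst₂ _≤_ λ₂≡λ₁+μ k≡λ₁+K λ₂≤k)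

  adjacent? : ∀ i j → Dec (Adj (qsBlockGraph D λ₂) i j)
  adjacent? i j = ¬? (i Fin.≟ j) ×-dec (inter D i j ≟ λ₂)

  a : Fin (b D) → Fin (b D) → ℕ
  a = adjacency (qsBlockGraph D λ₂) adjacent?

  a-sym : ∀ i j → a i j ≡ a j i
  a-sym i j = χ-does-⇔ flip flip (adjacent? i j) (adjacent? j i)
    where
    flip : ∀ {i j} → Adj (qsBlockGraph D λ₂) i j → Adj (qsBlockGraph D λ₂) j i
    flip {i} {j} (i≢j , ij≡λ₂) = (λ j≡i → i≢j (sym j≡i)) , trans (inter-sym j i) ij≡λ₂

  inter≡λ₁+μa+δK : ∀ i j → inter D i j ≡ λ₁ + μ * a i j + δ i j * K
  inter≡λ₁+μa+δK i j with toSum (i Fin.≟ j)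
  ... | inj₁ refl = begin
    inter D i i                   ≡⟨ trans (inter-diag i) (∣block∣≡k isDesign i) ⟩
    k                             ≡⟨ k≡λ₁+K ⟩
    λ₁ + K                        ≡⟨ diag λ₁ μ K ⟩
    λ₁ + μ * 0 + 1 * K            ≡⟨ cong₂ (λ y z → λ₁ + μ * y + z * K) (χ-does-no (adjacent? i i) (λ adj → proj₁ adj refl)) (δ-refl i) ⟨
    λ₁ + μ * a i i + δ i i * K    ∎
    where
    diag : ∀ x μ K → x + K ≡ x + μ * 0 + 1 * K
    diag = solve-∀
  ... | inj₂ i≢j with proj₁ (proj₂ (proj₂ qs)) i j i≢j
  ...   | inj₁ ij≡λ₁ = begin
    inter D i j                   ≡⟨ ij≡λ₁ ⟩
    λ₁                            ≡⟨ nonadjacent λ₁ μ K ⟩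
    λ₁ + μ * 0 + 0 * K            ≡⟨ cong₂ (λ y z → λ₁ + μ * y + z * K) (χ-does-no (adjacent? i j) (λ adj → <-irrefl (trans (sym ij≡λ₁) (proj₂ adj)) λ₁<λ₂)) (δ-≢ i≢j) ⟨
    λ₁ + μ * a i j + δ i j * K    ∎
    where
    nonadjacent : ∀ x μ K → x ≡ x + μ * 0 + 0 * K
    nonadjacent = solve-∀
  ...   | inj₂ ij≡λ₂ = begin
    inter D i j                   ≡⟨ trans ij≡λ₂ λ₂≡λ₁+μ ⟩
    λ₁ + μ                        ≡⟨ adjacent λ₁ μ K ⟩
    λ₁ + μ * 1 + 0 * K            ≡⟨ cong₂ (λ y z → λ₁ + μ * y + z * K) (χ-does-yes (adjacent? i j) (i≢j , ij≡λ₂)) (δ-≢ i≢j) ⟨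
    λ₁ + μ * a i j + δ i j * K    ∎
    where
    adjacent : ∀ x μ K → x + μ ≡ x + μ * 1 + 0 * K
    adjacent = solve-∀

  open TwoClassMatrix (inter D) a λ₁ μ K inter≡λ₁+μa+δK a-sym public

  row-equation : ∀ i → b D * λ₁ + μ * degree i + K ≡ k * r
  row-equation i = trans (sym (∑-row i)) (∑-inter≡k*r isDesign replication≡r i)

  square : ∀ i l → ∑[ j < b D ] (inter D i j * inter D j l) + λ′ * inter D i l ≡ λ′ * (k * k) + r * inter D i l
  square = ∑-inter² isDesign replication≡r

record Parameters (m n : ℕ) (D : Design) (λ₁ μ : ℕ) : Set where
  field
    k λ′ r : ℕ
    isDesign : IsDesign D k λ′
    replication≡r : ∀ p → Incidence.replication D p ≡ r
    k≡λ₁+μn : k ≡ λ₁ + μ * n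
    r+μ≡λ′+μm : r + μ ≡ λ′ + μ * m
    bλ₁+μnm≡kr : b D * λ₁ + μ * n * m ≡ k * r
    kr+λ′≡vλ′+r : k * r + λ′ ≡ v D * λ′ + r
    bk≡vr : b D * k ≡ v D * r
    bn+mm≡[mn+1]m : b D * n + m * m ≡ (m * n + 1) * m
    outside : ℕ  -- points outside two blocks that meet in λ₁ points
    outside+k+k≡v+λ₁ : outside + k + k ≡ v D + λ₁
    r≤b : r ≤ b D

module ℕ→ℤ where
  open import Data.Integer as ℤ using (ℤ; +_)
  open import Data.Integer.Properties using (pos-+; pos-*; +-injective; i-j≡0⇒i≡j; i*j≡0⇒i≡0∨j≡0)

  -- An equation between two expressions is moved between ℕ and ℤ by reading both sides in this syntax.

  infixl 6 _:+_
  infixl 7 _:*_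
  data Expr : Set where
    `     : ℕ → Expr
    _:+_ _:*_ : Expr → Expr → Expr

  ⟦_⟧ℕ : Expr → ℕ
  ⟦ ` a ⟧ℕ = a
  ⟦ e :+ f ⟧ℕ = ⟦ e ⟧ℕ + ⟦ f ⟧ℕ
  ⟦ e :* f ⟧ℕ = ⟦ e ⟧ℕ * ⟦ f ⟧ℕ

  ⟦_⟧ℤ : Expr → ℤ
  ⟦ ` a ⟧ℤ = + a
  ⟦ e :+ f ⟧ℤ = ⟦ e ⟧ℤ ℤ.+ ⟦ f ⟧ℤ
  ⟦ e :* f ⟧ℤ = ⟦ e ⟧ℤ ℤ.* ⟦ f ⟧ℤ

  +⟦⟧ℕ≡⟦⟧ℤ : ∀ e → + ⟦ e ⟧ℕ ≡ ⟦ e ⟧ℤ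
  +⟦⟧ℕ≡⟦⟧ℤ (` a) = refl
  +⟦⟧ℕ≡⟦⟧ℤ (e :+ f) = trans (pos-+ ⟦ e ⟧ℕ ⟦ f ⟧ℕ) (cong₂ ℤ._+_ (+⟦⟧ℕ≡⟦⟧ℤ e) (+⟦⟧ℕ≡⟦⟧ℤ f))
  +⟦⟧ℕ≡⟦⟧ℤ (e :* f) = trans (pos-* ⟦ e ⟧ℕ ⟦ f ⟧ℕ) (cong₂ ℤ._*_ (+⟦⟧ℕ≡⟦⟧ℤ e) (+⟦⟧ℕ≡⟦⟧ℤ f))

  lift : ∀ e f → ⟦ e ⟧ℕ ≡ ⟦ f ⟧ℕ → ⟦ e ⟧ℤ ≡ ⟦ f ⟧ℤ
  lift e f eq = trans (sym (+⟦⟧ℕ≡⟦⟧ℤ e)) (trans (cong +_ eq) (+⟦⟧ℕ≡⟦⟧ℤ f))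

  lower : ∀ e f → ⟦ e ⟧ℤ ≡ ⟦ f ⟧ℤ → ⟦ e ⟧ℕ ≡ ⟦ f ⟧ℕ
  lower e f eq = +-injective (trans (+⟦⟧ℕ≡⟦⟧ℤ e) (trans eq (sym (+⟦⟧ℕ≡⟦⟧ℤ f))))

  +-nonZero : ∀ {μ} → 1 ≤ μ → + μ ≢ ℤ.0ℤ
  +-nonZero {suc μ} _ ()

  K≡μn : ∀ K μ n e → 1 ≤ K → (+ K ℤ.- + μ ℤ.* + n) ℤ.* (+ K ℤ.+ + μ ℤ.* + e) ≡ ℤ.0ℤ → K ≡ μ * n
  K≡μn K μ n e 1≤K factorisation with i*j≡0⇒i≡0∨j≡0 (+ K ℤ.- + μ ℤ.* + n) factorisation
  ... | inj₁ K-μn≡0 = +-injective (trans (i-j≡0⇒i≡j _ _ K-μn≡0) (sym (pos-* μ n)))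
  ... | inj₂ K+μe≡0 with m+n≡0⇒m≡0 K (lower (` K :+ ` μ :* ` e) (` 0) K+μe≡0)
  ...   | refl = contradiction 1≤K (λ ())

  pair-equation : ∀ b x μ K λ′ k r d c α ε → PairEquation b x μ K λ′ k r d c α ε →
    ℤ-Identities.PairEquation (+ b) (+ x) (+ μ) (+ K) (+ λ′) (+ k) (+ r) (+ d) (+ c) (+ α) (+ ε)
  pair-equation b x μ K λ′ k r d c α ε =
    lift (` b :* (` x :* ` x) :+ ` x :* ` μ :* ` d :+ ` x :* ` μ :* ` d :+ ` μ :* ` μ :* ` c :+ ` K :* (` x :+ ` μ :* ` α)
            :+ ` K :* (` x :+ ` μ :* ` α) :+ ` ε :* (` K :* ` K) :+ ` λ′ :* (` x :+ ` μ :* ` α :+ ` ε :* ` K))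
         (` λ′ :* (` k :* ` k) :+ ` r :* (` x :+ ` μ :* ` α :+ ` ε :* ` K))

  solve-pair-equations : ∀ {b x μ K λ′ k r d c₀ c₁ c₂ n e} → 1 ≤ μ → μ ≤ K →
    PairEquation b x μ K λ′ k r d c₁ 1 0 → PairEquation b x μ K λ′ k r d c₀ 0 0 → PairEquation b x μ K λ′ k r d c₂ 0 1 →
    c₀ ≡ n * n → c₁ + n + n + 1 ≡ n * n + (1 + n + e) → c₂ + n ≡ (1 + n + e) * n →
    K ≡ μ * n × r ≡ λ′ + μ * (n + e)
  solve-pair-equations {b} {x} {μ} {K} {λ′} {k} {r} {d} {c₀} {c₁} {c₂} {n} {e}
    1≤μ μ≤K adjacent nonadjacent diagonal c₀≡ c₁≡ c₂≡ = K≡μn′ , r≡λ′+μ[n+e]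
    where
    c₀≡ℤ : + c₀ ≡ + n ℤ.* + n
    c₀≡ℤ = lift (` c₀) (` n :* ` n) c₀≡
    c₁≡ℤ : + c₁ ℤ.+ + n ℤ.+ + n ℤ.+ ℤ.1ℤ ≡ + n ℤ.* + n ℤ.+ (ℤ.1ℤ ℤ.+ + n ℤ.+ + e)
    c₁≡ℤ = lift (` c₁ :+ ` n :+ ` n :+ ` 1) (` n :* ` n :+ (` 1 :+ ` n :+ ` e)) c₁≡
    X≡0 : + μ ℤ.* (+ c₁ ℤ.- + c₀) ℤ.+ + K ℤ.+ + K ℤ.+ + λ′ ℤ.- + r ≡ ℤ.0ℤ
    X≡0 = ℤ-Identities.adjacent-nonadjacent (+ b) (+ x) (+ μ) (+ K) (+ k) (+ λ′) (+ r) (+ d) (+ c₁) (+ c₀) (+-nonZero 1≤μ)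
      (pair-equation b x μ K λ′ k r d c₁ 1 0 adjacent) (pair-equation b x μ K λ′ k r d c₀ 0 0 nonadjacent)
    K≡μn′ : K ≡ μ * n
    K≡μn′ = K≡μn K μ n e (≤-trans 1≤μ μ≤K) (ℤ-Identities.diagonal-factorisation
      (+ b) (+ x) (+ μ) (+ K) (+ k) (+ λ′) (+ r) (+ d) (+ c₀) (+ c₁) (+ c₂) (+ n) (+ e)
      (pair-equation b x μ K λ′ k r d c₂ 0 1 diagonal) (pair-equation b x μ K λ′ k r d c₀ 0 0 nonadjacent)
      X≡0 c₀≡ℤ c₁≡ℤ (lift (` c₂ :+ ` n) ((` 1 :+ ` n :+ ` e) :* ` n) c₂≡))
    r≡λ′+μ[n+e] : r ≡ λ′ + μ * (n + e)
    r≡λ′+μ[n+e] = lower (` r) (` λ′ :+ ` μ :* (` n :+ ` e))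
      (ℤ-Identities.replication-formula (+ μ) (+ K) (+ λ′) (+ r) (+ c₀) (+ c₁) (+ n) (+ e) X≡0 (trans (cong +_ K≡μn′) (pos-* μ n)) c₀≡ℤ c₁≡ℤ)

  parameter-identity : ∀ {m n D λ₁ μ} → 1 ≤ μ → (P : Parameters m n D λ₁ μ) →
    ℤ-Identities.ParameterIdentity (+ m) (+ n) (+ b D) (+ Parameters.r P) (+ μ)
  parameter-identity {m} {n} {D} {λ₁} {μ} 1≤μ P =
    ℤ-Identities.parameter-identity (+ λ₁) (+ r) (+ b D) (+ v D) (+ m) (+ n) (+ μ) (+ k) (+ λ′) (+-nonZero 1≤μ)
      (lift (` k) (` λ₁ :+ ` μ :* ` n) k≡λ₁+μn)
      (lift (` r :+ ` μ) (` λ′ :+ ` μ :* ` m) r+μ≡λ′+μm)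
      (lift (` (b D) :* ` λ₁ :+ ` μ :* ` n :* ` m) (` k :* ` r) bλ₁+μnm≡kr)
      (lift (` k :* ` r :+ ` λ′) (` (v D) :* ` λ′ :+ ` r) kr+λ′≡vλ′+r)
      (lift (` (b D) :* ` k) (` (v D) :* ` r) bk≡vr)
      (lift (` (b D) :* ` n :+ ` m :* ` m) ((` m :* ` n :+ ` 1) :* ` m) bn+mm≡[mn+1]m)
    where open Parameters P

  μ≡1-dichotomy : ∀ {m n D λ₁ t} → 2 ≤ m → (P : Parameters m n D λ₁ 1) → b D ≡ m + t →
    Parameters.r P ≡ m ⊎ m + Parameters.r P ≡ b D
  μ≡1-dichotomy {suc m₁} {n} {D} {t = t} (s≤s 1≤m₁) P b≡m+t
    with i*j≡0⇒i≡0∨j≡0 _ (ℤ-Identities.parameter-identity-μ≡1 (+ suc m₁) (+ n) (+ b D) (+ Parameters.r P) (+ t) (+ m₁)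
                            (lift (` (b D)) (` (suc m₁) :+ ` t) b≡m+t) refl (parameter-identity (s≤s z≤n) P))
  ... | inj₂ b-[m+r]≡0 = inj₂ (lower (` (suc m₁) :+ ` (Parameters.r P)) (` (b D)) (sym (i-j≡0⇒i≡j _ _ b-[m+r]≡0)))
  ... | inj₁ [m₁+nt][r-m]≡0 with i*j≡0⇒i≡0∨j≡0 _ [m₁+nt][r-m]≡0
  ...   | inj₂ r-m≡0 = inj₁ (+-injective (i-j≡0⇒i≡j _ _ r-m≡0))
  ...   | inj₁ m₁+nt≡0 = contradiction (m+n≡0⇒m≡0 m₁ (lower (` m₁ :+ ` n :* ` t) (` 0) m₁+nt≡0)) (≢-nonZero⁻¹ m₁)
    where instance _ = >-nonZero 1≤m₁

  module _ {m₁ n D λ₁ μ₁} (P : Parameters (suc m₁) n D λ₁ (suc μ₁)) where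
    open Parameters P
    private
      m μ : ℕ
      m = suc m₁
      μ = suc μ₁

    μ≥2-sign : ∀ {u t s} → r ≡ m + u → b D ≡ m + t → t + s ≡ r →
      (m₁ + n * t) * u * s + μ₁ * m₁ * b D * n * t ≡ 0
    μ≥2-sign {u} {t} {s} r≡m+u b≡m+t t+s≡r =
      lower ((` m₁ :+ ` n :* ` t) :* ` u :* ` s :+ ` μ₁ :* ` m₁ :* ` (b D) :* ` n :* ` t) (` 0)
        (ℤ-Identities.parameter-identity-sign (+ m) (+ b D) (+ r) (+ μ) (+ m₁) (+ u) (+ t) (+ s) (+ n) (+ μ₁)
          (lift (` m) (` 1 :+ ` m₁) refl) (lift (` r) (` m :+ ` u) r≡m+u) (lift (` (b D)) (` m :+ ` t) b≡m+t)
          (lift (` μ) (` 1 :+ ` μ₁) refl) (lift (` t :+ ` s) (` r) t+s≡r) (parameter-identity (s≤s z≤n) P))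

    μ≥2-split : ∀ {u t w} → r ≡ m + u → t ≡ r + w → b D ≡ m + t →
      (m₁ + n * t) * u * w ≡ μ₁ * m₁ * b D * n * t
    μ≥2-split {u} {t} {w} r≡m+u t≡r+w b≡m+t =
      lower ((` m₁ :+ ` n :* ` t) :* ` u :* ` w) (` μ₁ :* ` m₁ :* ` (b D) :* ` n :* ` t)
        (ℤ-Identities.parameter-identity-split (+ m) (+ b D) (+ r) (+ μ) (+ t) (+ m₁) (+ u) (+ w) (+ n) (+ μ₁)
          (lift (` m) (` 1 :+ ` m₁) refl) (lift (` r) (` m :+ ` u) r≡m+u) (lift (` t) (` r :+ ` w) t≡r+w)
          (lift (` (b D)) (` m :+ ` t) b≡m+t) (lift (` μ) (` 1 :+ ` μ₁) refl) (parameter-identity (s≤s z≤n) P))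

    λ₁-identity : ∀ {u t w} → r ≡ m + u → t ≡ r + w → b D ≡ m + t → λ₁ * (m + w) ≡ μ * n * u
    λ₁-identity {u} {t} {w} r≡m+u t≡r+w b≡m+t =
      lower (` λ₁ :* (` m :+ ` w)) (` μ :* ` n :* ` u)
        (ℤ-Identities.λ₁-identity (+ λ₁) (+ r) (+ b D) (+ m) (+ μ) (+ n) (+ k) (+ u) (+ w) (+ t)
          (lift (` k) (` λ₁ :+ ` μ :* ` n) k≡λ₁+μn) (lift (` (b D)) (` m :+ ` t) b≡m+t)
          (lift (` t) (` r :+ ` w) t≡r+w) (lift (` r) (` m :+ ` u) r≡m+u)
          (lift (` (b D) :* ` λ₁ :+ ` μ :* ` n :* ` m) (` k :* ` r) bλ₁+μnm≡kr))

    outside-identity : ∀ {t w} → t ≡ r + w → b D ≡ m + t → outside * r ≡ μ * n * w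
    outside-identity {t} {w} t≡r+w b≡m+t =
      lower (` outside :* ` r) (` μ :* ` n :* ` w)
        (ℤ-Identities.outside-identity (+ outside) (+ λ₁) (+ r) (+ b D) (+ m) (+ μ) (+ n) (+ k) (+ v D) (+ w) (+ t)
          (lift (` k) (` λ₁ :+ ` μ :* ` n) k≡λ₁+μn) (lift (` (b D)) (` m :+ ` t) b≡m+t) (lift (` t) (` r :+ ` w) t≡r+w)
          (lift (` outside :+ ` k :+ ` k) (` (v D) :+ ` λ₁) outside+k+k≡v+λ₁)
          (lift (` (b D) :* ` k) (` (v D) :* ` r) bk≡vr)
          (lift (` (b D) :* ` λ₁ :+ ` μ :* ` n :* ` m) (` k :* ` r) bλ₁+μnm≡kr))

m*[1+n]∸m≡m*n : ∀ m n → m * suc n ∸ m ≡ m * n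
m*[1+n]∸m≡m*n m n = trans (cong (_∸ m) (*-suc m n)) (m+n∸m≡n m (m * n))

m*n∸m+1+m≡m*n+1 : ∀ m {n} → 1 ≤ n → m * n ∸ m + 1 + m ≡ m * n + 1
m*n∸m+1+m≡m*n+1 m {suc n} _ = begin
  m * suc n ∸ m + 1 + m  ≡⟨ cong (λ y → y + 1 + m) (m*[1+n]∸m≡m*n m n) ⟩
  m * n + 1 + m          ≡⟨ regroup m n ⟩
  m * suc n + 1          ∎
  where
  open ≡-Reasoning
  regroup : ∀ m n → m * n + 1 + m ≡ m * (1 + n) + 1
  regroup = solve-∀

steiner-replication : ∀ {n m r} → 2 ≤ n → n * r + 1 ≡ (m * n ∸ m + 1) * 1 + r → r ≡ m
steiner-replication {suc (suc n₂)} {m} {r} (s≤s (s≤s z≤n)) eq =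
  *-cancelˡ-≡ r m (suc n₂) (+-cancelʳ-≡ (r + 1) _ _ (begin
    suc n₂ * r + (r + 1)             ≡⟨ peel n₂ r ⟩
    suc (suc n₂) * r + 1             ≡⟨ eq ⟩
    (m * suc (suc n₂) ∸ m + 1) * 1 + r ≡⟨ cong (λ y → (y + 1) * 1 + r) (m*[1+n]∸m≡m*n m (suc n₂)) ⟩
    (m * suc n₂ + 1) * 1 + r         ≡⟨ regroup m n₂ r ⟩
    suc n₂ * m + (r + 1)             ∎))
  where
  open ≡-Reasoning
  peel : ∀ n r → (1 + n) * r + (r + 1) ≡ (2 + n) * r + 1
  peel = solve-∀
  regroup : ∀ m n r → (m * (1 + n) + 1) * 1 + r ≡ (1 + n) * m + (r + 1)
  regroup = solve-∀

module SteinerGraphParameters {m n : ℕ} (2≤n : 2 ≤ n) (n<m : n < m) (D : Design) {λ₁ λ₂ μ : ℕ}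
  (qs : IsQuasiSymmetric D λ₁ λ₂) (λ₂≡λ₁+μ : λ₂ ≡ λ₁ + μ) (sg : IsSteinerGraph n m (qsBlockGraph D λ₂)) where
  open ≡-Reasoning

  private
    E : Design
    E = proj₁ (proj₂ (proj₂ (proj₂ sg)))
    v-E≡ : v E ≡ m * n ∸ m + 1
    v-E≡ = proj₁ (proj₂ (proj₂ (proj₂ (proj₂ sg))))
    isSteiner : IsDesign E n 1
    isSteiner = proj₁ (proj₂ (proj₂ (proj₂ (proj₂ (proj₂ sg)))))
    D≅E : qsBlockGraph D λ₂ ≅G steinerBlockGraph E
    D≅E = proj₂ (proj₂ (proj₂ (proj₂ (proj₂ (proj₂ sg)))))

    module Q = QuasiSymmetric D qs λ₂≡λ₁+μ
    module S = SteinerBlockGraph E isSteiner 2≤n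

    to : Fin (b D) → Fin (b E)
    to = Inverse.to (proj₁ D≅E)

    to-injective : ∀ {i j} → to i ≡ to j → i ≡ j
    to-injective = Injection.injective (↔⇒↣ (proj₁ D≅E))

    a-D≡a-E : ∀ i j → Q.a i j ≡ S.a (to i) (to j)
    a-D≡a-E = adjacency-≅ Q.adjacent? S.adjacent? D≅E

    r-E≡m : S.r ≡ m
    r-E≡m = steiner-replication 2≤n (trans (Incidence.replication₀-equation E isSteiner) (cong (λ y → y * 1 + S.r) v-E≡))

    e : ℕ
    e = proj₁ (m≤n⇒∃[o]m+o≡n n<m)
    m≡1+n+e : m ≡ 1 + n + e
    m≡1+n+e = sym (proj₂ (m≤n⇒∃[o]m+o≡n n<m))

    degree+n≡nm : ∀ i → Q.degree i + n ≡ n * m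
    degree+n≡nm i = trans (cong (_+ n) (degree-≅ Q.adjacent? S.adjacent? D≅E i))
                          (trans (S.degree+k≡k*r (to i)) (cong (n *_) r-E≡m))

    d₀ : ℕ
    d₀ = n * m ∸ n

    degree≡d₀ : ∀ i → Q.degree i ≡ d₀
    degree≡d₀ i = trans (sym (m+n∸n≡m (Q.degree i) n)) (cong (_∸ n) (degree+n≡nm i))

    a₂ : Q.a Q.i₂ Q.j₂ ≡ 1
    a₂ = χ-does-yes (Q.adjacent? Q.i₂ Q.j₂) (Q.i₂≢j₂ , Q.inter₂)
    a₁ : Q.a Q.i₁ Q.j₁ ≡ 0
    a₁ = χ-does-no (Q.adjacent? Q.i₁ Q.j₁) (λ adj → <-irrefl (trans (sym Q.inter₁) (proj₂ adj)) Q.λ₁<λ₂)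
    a₀ : Q.a Q.i₁ Q.i₁ ≡ 0
    a₀ = χ-does-no (Q.adjacent? Q.i₁ Q.i₁) (λ adj → proj₁ adj refl)

    c₀ c₁ c₂ : ℕ
    c₀ = Q.common Q.i₁ Q.j₁
    c₁ = Q.common Q.i₂ Q.j₂
    c₂ = Q.common Q.i₁ Q.i₁

    c₀≡ : c₀ ≡ n * n
    c₀≡ = trans (common-≅ Q.adjacent? S.adjacent? D≅E Q.i₁ Q.j₁)
                (S.common-nonadjacent (to Q.i₁) (to Q.j₁) (λ eq → Q.i₁≢j₁ (to-injective eq)) (trans (sym (a-D≡a-E Q.i₁ Q.j₁)) a₁))
    c₁≡ : c₁ + n + n + 1 ≡ n * n + (1 + n + e)
    c₁≡ = trans (cong (λ c → c + n + n + 1) (common-≅ Q.adjacent? S.adjacent? D≅E Q.i₂ Q.j₂))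
                (trans (S.common-adjacent (to Q.i₂) (to Q.j₂) (trans (sym (a-D≡a-E Q.i₂ Q.j₂)) a₂))
                       (cong (n * n +_) (trans r-E≡m m≡1+n+e)))
    c₂≡ : c₂ + n ≡ (1 + n + e) * n
    c₂≡ = trans (cong (_+ n) (common-≅ Q.adjacent? S.adjacent? D≅E Q.i₁ Q.i₁))
                (trans (S.common-diag (to Q.i₁)) (cong (_* n) (trans r-E≡m m≡1+n+e)))

    solved : Q.K ≡ μ * n × Q.r ≡ Q.λ′ + μ * (n + e)
    solved = ℕ→ℤ.solve-pair-equations {b D} {λ₁} {μ} {Q.K} {Q.λ′} {Q.k} {Q.r} {d₀} {c₀} {c₁} {c₂} {n} {e} Q.1≤μ Q.μ≤K
      (Q.pair-equation {Q.λ′} {Q.k} {Q.r} Q.square degree≡d₀ {Q.i₂} {Q.j₂} a₂ (δ-≢ Q.i₂≢j₂))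
      (Q.pair-equation {Q.λ′} {Q.k} {Q.r} Q.square degree≡d₀ {Q.i₁} {Q.j₁} a₁ (δ-≢ Q.i₁≢j₁))
      (Q.pair-equation {Q.λ′} {Q.k} {Q.r} Q.square degree≡d₀ {Q.i₁} {Q.i₁} a₀ (δ-refl Q.i₁))
      c₀≡ c₁≡ c₂≡

  parameters : Parameters m n D λ₁ μ
  parameters = record
    { k = Q.k ; λ′ = Q.λ′ ; r = Q.r
    ; isDesign = Q.isDesign
    ; replication≡r = Q.replication≡r
    ; k≡λ₁+μn = trans Q.k≡λ₁+K (cong (λ₁ +_) (proj₁ solved))
    ; r+μ≡λ′+μm = r+μ≡λ′+μm
    ; bλ₁+μnm≡kr = bλ₁+μnm≡kr
    ; kr+λ′≡vλ′+r = Incidence.replication₀-equation D Q.isDesign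
    ; bk≡vr = Incidence.b*k≡v*r D Q.isDesign Q.replication≡r
    ; bn+mm≡[mn+1]m = begin
        b D * n + m * m          ≡⟨ cong (λ y → y * n + m * m) (↔⇒≡ (proj₁ D≅E)) ⟩
        b E * n + m * m          ≡⟨ cong (_+ m * m) (trans (Incidence.b*k≡v*r E isSteiner S.replication≡r) (cong (v E *_) r-E≡m)) ⟩
        v E * m + m * m          ≡⟨ *-distribʳ-+ m (v E) m ⟨
        (v E + m) * m            ≡⟨ cong (λ y → (y + m) * m) v-E≡ ⟩
        (m * n ∸ m + 1 + m) * m  ≡⟨ cong (_* m) (m*n∸m+1+m≡m*n+1 m (≤-trans (s≤s z≤n) 2≤n)) ⟩
        (m * n + 1) * m          ∎
    ; outside = inter (complement D) Q.i₁ Q.j₁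
    ; outside+k+k≡v+λ₁ = trans (cong₂ (λ y z → inter (complement D) Q.i₁ Q.j₁ + y + z)
                                       (sym (Incidence.∣block∣≡k D Q.isDesign Q.i₁)) (sym (Incidence.∣block∣≡k D Q.isDesign Q.j₁)))
                                (trans (Incidence.inter-complement D Q.i₁ Q.j₁) (cong (v D +_) Q.inter₁))
    ; r≤b = Incidence.replication≤b D _
    }
    where
    r+μ≡λ′+μm : Q.r + μ ≡ Q.λ′ + μ * m
    r+μ≡λ′+μm = begin
      Q.r + μ                   ≡⟨ cong (_+ μ) (proj₂ solved) ⟩
      Q.λ′ + μ * (n + e) + μ    ≡⟨ regroup Q.λ′ μ n e ⟩
      Q.λ′ + μ * (1 + n + e)    ≡⟨ cong (λ y → Q.λ′ + μ * y) m≡1+n+e ⟨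
      Q.λ′ + μ * m              ∎
      where
      regroup : ∀ l μ n e → l + μ * (n + e) + μ ≡ l + μ * (1 + n + e)
      regroup = solve-∀
    bλ₁+μnm≡kr : b D * λ₁ + μ * n * m ≡ Q.k * Q.r
    bλ₁+μnm≡kr = begin
      b D * λ₁ + μ * n * m          ≡⟨ cong (b D * λ₁ +_) (trans (*-assoc μ n m) (cong (μ *_) (sym (degree+n≡nm Q.i₁)))) ⟩
      b D * λ₁ + μ * (d + n)        ≡⟨ regroup (b D) λ₁ μ d n ⟩
      b D * λ₁ + μ * d + μ * n      ≡⟨ cong (b D * λ₁ + μ * d +_) (proj₁ solved) ⟨
      b D * λ₁ + μ * d + Q.K        ≡⟨ Q.row-equation Q.i₁ ⟩
      Q.k * Q.r                     ∎
      where
      d : ℕ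
      d = Q.degree Q.i₁
      regroup : ∀ b x μ d n → b * x + μ * (d + n) ≡ b * x + μ * d + μ * n
      regroup = solve-∀

excess-blocks : ∀ {b m₁ n₁} → b * suc n₁ + suc m₁ * suc m₁ ≡ (suc m₁ * suc n₁ + 1) * suc m₁ →
  Σ ℕ λ t → b ≡ suc m₁ + t × t * suc n₁ ≡ suc m₁ * m₁ * n₁
excess-blocks {b} {m₁} {n₁} eq = b ∸ m , sym (m+[n∸m]≡n m≤b) , +-cancelˡ-≡ (m * n) _ _ (begin
  m * n + (b ∸ m) * n       ≡⟨ *-distribʳ-+ n m (b ∸ m) ⟨
  (m + (b ∸ m)) * n         ≡⟨ cong (_* n) (m+[n∸m]≡n m≤b) ⟩
  b * n                     ≡⟨ bn≡ ⟩
  m * n + m * m₁ * n₁       ∎)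
  where
  open ≡-Reasoning
  m n : ℕ
  m = suc m₁
  n = suc n₁
  expand : ∀ m₁ n₁ → (suc m₁ * suc n₁ + 1) * suc m₁ ≡ suc m₁ * suc n₁ + suc m₁ * m₁ * n₁ + suc m₁ * suc m₁
  expand = solve-∀
  bn≡ : b * n ≡ m * n + m * m₁ * n₁
  bn≡ = +-cancelʳ-≡ (m * m) _ _ (trans eq (expand m₁ n₁))
  m≤b : m ≤ b
  m≤b = *-cancelʳ-≤ m b n (subst (m * n ≤_) (sym bn≡) (m≤m+n (m * n) (m * m₁ * n₁)))

defect-one-parameters : ∀ {m₁ n₁ D λ₁} → 1 ≤ m₁ → Parameters (suc m₁) (suc n₁) D λ₁ 1 →
  IsSteiner D ⊎ IsSteiner (complement D)
defect-one-parameters {m₁} {n₁} {D} {λ₁} 1≤m₁ P =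
  [ (λ r≡m → inj₁ (steiner r≡m)) , (λ m+r≡b → inj₂ (complement-steiner m+r≡b)) ]′
    (ℕ→ℤ.μ≡1-dichotomy (s≤s 1≤m₁) P (proj₁ (proj₂ (excess-blocks {b D} {m₁} {n₁} bn+mm≡[mn+1]m))))
  where
  open Parameters P
  open ≡-Reasoning
  m : ℕ
  m = suc m₁
  r+1≡λ′+m : r + 1 ≡ λ′ + m
  r+1≡λ′+m = trans r+μ≡λ′+μm (cong (λ′ +_) (+-identityʳ m))
  steiner : r ≡ m → IsSteiner D
  steiner r≡m = k , subst (IsDesign D k) λ′≡1 isDesign
    where
    λ′≡1 : λ′ ≡ 1
    λ′≡1 = +-cancelʳ-≡ m λ′ 1 (trans (sym r+1≡λ′+m) (trans (cong (_+ 1) r≡m) (+-comm m 1)))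
  complement-steiner : m + r ≡ b D → IsSteiner (complement D)
  complement-steiner m+r≡b = v D ∸ k , Incidence.complement-isDesign D isDesign replication≡r 1≤k ≤-refl balance
    where
    1≤k : 1 ≤ k
    1≤k = subst (1 ≤_) (sym k≡λ₁+μn) (≤-trans (s≤s z≤n) (m≤n+m (1 * suc n₁) λ₁))
    balance : 1 + r + r ≡ b D + λ′
    balance = begin
      1 + r + r          ≡⟨ regroup r ⟩
      r + (r + 1)        ≡⟨ cong (r +_) r+1≡λ′+m ⟩
      r + (λ′ + m)       ≡⟨ regroup′ r λ′ m ⟩
      m + r + λ′         ≡⟨ cong (_+ λ′) m+r≡b ⟩
      b D + λ′           ∎
      where
      regroup : ∀ r → 1 + r + r ≡ r + (r + 1)
      regroup = solve-∀
      regroup′ : ∀ r l m → r + (l + m) ≡ m + r + l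
      regroup′ = solve-∀

square-bound : ∀ u w p → 1 ≤ p → u ≤ p * w → w ≤ p * u → (u + w) * (u + w) ≤ 4 * p * (u * w)
square-bound u w p 1≤p u≤pw w≤pu = begin
  (u + w) * (u + w)                                        ≡⟨ expand u w ⟩
  u * u + (u * w + u * w) + w * w                          ≤⟨ +-mono-≤ (+-mono-≤ u²≤ (+-mono-≤ uw≤ uw≤)) w²≤ ⟩
  p * (u * w) + (p * (u * w) + p * (u * w)) + p * (u * w)  ≡⟨ collect p (u * w) ⟩
  4 * p * (u * w)                                          ∎
  where
  open ≤-Reasoning
  expand : ∀ u w → (u + w) * (u + w) ≡ u * u + (u * w + u * w) + w * w
  expand = solve-∀
  collect : ∀ p q → p * q + (p * q + p * q) + p * q ≡ 4 * p * q
  collect = solve-∀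
  swap : ∀ u p w → u * (p * w) ≡ p * (u * w)
  swap = solve-∀
  u²≤ : u * u ≤ p * (u * w)
  u²≤ = subst (u * u ≤_) (swap u p w) (*-monoʳ-≤ u u≤pw)
  w²≤ : w * w ≤ p * (u * w)
  w²≤ = subst (w * w ≤_) (trans (swap w p u) (cong (p *_) (*-comm w u))) (*-monoʳ-≤ w w≤pu)
  uw≤ : u * w ≤ p * (u * w)
  uw≤ = subst (_≤ p * (u * w)) (*-identityˡ (u * w)) (*-monoˡ-≤ (u * w) 1≤p)

quadratic-bound : ∀ s C n → 1 ≤ C → s * s ≤ C * (2 * n + s) → s ≤ 2 * n ⊎ s ≤ 2 * C
quadratic-bound s C n 1≤C s²≤ with s ≤? 2 * n | s ≤? 2 * C
... | yes s≤2n | _ = inj₁ s≤2n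
... | no _ | yes s≤2C = inj₂ s≤2C
... | no s≰2n | no s≰2C = contradiction s²≤ (<⇒≱ (begin-strict
  C * (2 * n + s) <⟨ *-monoʳ-< C {{>-nonZero 1≤C}} (+-monoˡ-< s (≰⇒> s≰2n)) ⟩
  C * (s + s)     ≡⟨ double C s ⟩
  2 * C * s       <⟨ *-monoˡ-< s {{>-nonZero (≤-<-trans z≤n (≰⇒> s≰2C))}} (≰⇒> s≰2C) ⟩
  s * s           ∎))
  where
  open ≤-Reasoning
  double : ∀ C s → C * (s + s) ≡ 2 * C * s
  double = solve-∀

m-bound : ℕ → ℕ → ℕ
m-bound μ n = 4 * n + 2 * (4 * (μ * μ) * (n * n))

-- Here m = 1 + m₁, n = 1 + n₁, μ = 1 + μ₁, r = m + u, t = r + w and b = m + t. Each of u, w is at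
-- most μn times the other, so (u + w)² ≤ 4μn·uw ≤ 4μ²n·mb, and n(u + w) = s·m where
-- s = m n₁ + 1 − 2n; hence s² ≤ 4μ²n²(2n + s), which bounds s and so m.
module DefectBound {m₁ n₁ μ₁ u w x z r t b : ℕ} (1≤n₁ : 1 ≤ n₁) (1≤u : 1 ≤ u) (1≤w : 1 ≤ w)
  (r≡m+u : r ≡ suc m₁ + u) (t≡r+w : t ≡ r + w) (b≡m+t : b ≡ suc m₁ + t)
  (split : (m₁ + suc n₁ * t) * u * w ≡ μ₁ * m₁ * b * suc n₁ * t)
  (λ₁-eq : x * (suc m₁ + w) ≡ suc μ₁ * suc n₁ * u)
  (outside-eq : z * r ≡ suc μ₁ * suc n₁ * w)
  (excess : t * suc n₁ ≡ suc m₁ * m₁ * n₁) where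

  private
    m n μ p C : ℕ
    m = suc m₁
    n = suc n₁
    μ = suc μ₁
    p = μ * n
    C = 4 * (μ * μ) * (n * n)

    1≤p : 1 ≤ p
    1≤p = s≤s z≤n

    ≤-multiple : ∀ {c a d} → c * a ≡ d → 1 ≤ d → a ≤ d
    ≤-multiple {zero} refl ()
    ≤-multiple {suc c} {a} refl _ = m≤m+n a (c * a)

    w≤pu : w ≤ p * u
    w≤pu = ≤-trans (m≤n+m w m) (≤-multiple {x} λ₁-eq (*-mono-≤ 1≤p 1≤u))

    u≤pw : u ≤ p * w
    u≤pw = ≤-trans (≤-trans (m≤n+m u m) (≤-reflexive (sym r≡m+u))) (≤-multiple {z} outside-eq (*-mono-≤ 1≤p 1≤w))

    uw≤μmb : u * w ≤ μ * m * b
    uw≤μmb = *-cancelˡ-≤ (n * t) {{nonZero-nt}} (begin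
      n * t * (u * w)        ≤⟨ *-monoˡ-≤ (u * w) (m≤n+m (n * t) m₁) ⟩
      (m₁ + n * t) * (u * w) ≡⟨ *-assoc (m₁ + n * t) u w ⟨
      (m₁ + n * t) * u * w   ≡⟨ split ⟩
      μ₁ * m₁ * b * n * t    ≤⟨ *-monoˡ-≤ t (*-monoˡ-≤ n (*-monoˡ-≤ b (*-mono-≤ (n≤1+n μ₁) (n≤1+n m₁)))) ⟩
      μ * m * b * n * t      ≡⟨ regroup μ m b n t ⟩
      n * t * (μ * m * b)    ∎)
      where
      open ≤-Reasoning
      regroup : ∀ μ m b n t → μ * m * b * n * t ≡ n * t * (μ * m * b)
      regroup = solve-∀
      nonZero-nt : NonZero (n * t)
      nonZero-nt = >-nonZero (*-mono-≤ (s≤s (z≤n {n₁})) (subst (1 ≤_) (sym t≡r+w) (≤-trans 1≤w (m≤n+m w r))))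

    S T : ℕ
    S = u + w
    T = m * n₁ + 1

    S²≤ : S * S ≤ 4 * p * (μ * m * b)
    S²≤ = ≤-trans (square-bound u w p 1≤p u≤pw w≤pu) (*-monoʳ-≤ (4 * p) uw≤μmb)

    b≡m+m+S : b ≡ m + m + S
    b≡m+m+S = trans b≡m+t (trans (cong (m +_) (trans t≡r+w (cong (_+ w) r≡m+u))) (regroup m u w))
      where
      regroup : ∀ m u w → m + (m + u + w) ≡ m + m + (u + w)
      regroup = solve-∀

    bn≡Tm : b * n ≡ T * m
    bn≡Tm = begin
      b * n                    ≡⟨ cong (_* n) b≡m+t ⟩
      (m + t) * n              ≡⟨ *-distribʳ-+ n m t ⟩
      m * n + t * n            ≡⟨ cong (m * n +_) excess ⟩
      m * n + m * m₁ * n₁      ≡⟨ regroup m₁ n₁ ⟩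
      T * m                    ∎
      where
      open ≡-Reasoning
      regroup : ∀ m₁ n₁ → suc m₁ * suc n₁ + suc m₁ * m₁ * n₁ ≡ (suc m₁ * n₁ + 1) * suc m₁
      regroup = solve-∀

    m≤T : m ≤ T
    m≤T = ≤-trans (m≤m*n m n₁ {{>-nonZero 1≤n₁}}) (m≤m+n (m * n₁) 1)

    C-positive : 1 ≤ C
    C-positive = s≤s z≤n

    module _ (2n≤T : 2 * n ≤ T) where
      s : ℕ
      s = T ∸ 2 * n

      T≡2n+s : T ≡ 2 * n + s
      T≡2n+s = sym (m+[n∸m]≡n 2n≤T)

      nS≡sm : n * S ≡ s * m
      nS≡sm = +-cancelˡ-≡ (2 * n * m) _ _ (begin
        2 * n * m + n * S     ≡⟨ regroup n m S ⟩
        n * (m + m + S)       ≡⟨ cong (n *_) b≡m+m+S ⟨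
        n * b                 ≡⟨ *-comm n b ⟩
        b * n                 ≡⟨ bn≡Tm ⟩
        T * m                 ≡⟨ cong (_* m) T≡2n+s ⟩
        (2 * n + s) * m       ≡⟨ *-distribʳ-+ m (2 * n) s ⟩
        2 * n * m + s * m     ∎)
        where
        open ≡-Reasoning
        regroup : ∀ n m S → 2 * n * m + n * S ≡ n * (m + m + S)
        regroup = solve-∀

      s²≤ : s * s ≤ C * (2 * n + s)
      s²≤ = *-cancelˡ-≤ (m * m) (begin
        m * m * (s * s)                 ≡⟨ square-swap m s ⟩
        (s * m) * (s * m)               ≡⟨ cong₂ _*_ nS≡sm nS≡sm ⟨
        (n * S) * (n * S)               ≡⟨ square-swap′ n S ⟩
        n * n * (S * S)                 ≤⟨ *-monoʳ-≤ (n * n) S²≤ ⟩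
        n * n * (4 * p * (μ * m * b))   ≡⟨ regroup n μ m b ⟩
        C * m * (b * n)                 ≡⟨ cong (C * m *_) (trans bn≡Tm (cong (_* m) T≡2n+s)) ⟩
        C * m * ((2 * n + s) * m)       ≡⟨ regroup′ C m (2 * n + s) ⟩
        m * m * (C * (2 * n + s))       ∎)
        where
        open ≤-Reasoning
        square-swap : ∀ m s → m * m * (s * s) ≡ (s * m) * (s * m)
        square-swap = solve-∀
        square-swap′ : ∀ n S → (n * S) * (n * S) ≡ n * n * (S * S)
        square-swap′ = solve-∀
        regroup : ∀ n μ m b → n * n * (4 * (μ * n) * (μ * m * b)) ≡ 4 * (μ * μ) * (n * n) * m * (b * n)
        regroup = solve-∀
        regroup′ : ∀ C m q → C * m * (q * m) ≡ m * m * (C * q)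
        regroup′ = solve-∀

      s≤2n+2C : s ≤ 2 * n + 2 * C
      s≤2n+2C = [ (λ s≤2n → ≤-trans s≤2n (m≤m+n (2 * n) (2 * C))) , (λ s≤2C → ≤-trans s≤2C (m≤n+m (2 * C) (2 * n))) ]′
                  (quadratic-bound s C n C-positive s²≤)

    T≤4n+2C : T ≤ 4 * n + 2 * C
    T≤4n+2C with 2 * n ≤? T
    ... | yes 2n≤T = begin
      T                          ≡⟨ T≡2n+s 2n≤T ⟩
      2 * n + s 2n≤T             ≤⟨ +-monoʳ-≤ (2 * n) (s≤2n+2C 2n≤T) ⟩
      2 * n + (2 * n + 2 * C)    ≡⟨ regroup n C ⟩
      4 * n + 2 * C              ∎
      where
      open ≤-Reasoning
      regroup : ∀ n C → 2 * n + (2 * n + 2 * C) ≡ 4 * n + 2 * C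
      regroup = solve-∀
    ... | no 2n≰T = ≤-trans (<⇒≤ (≰⇒> 2n≰T)) (≤-trans (*-monoˡ-≤ n (s≤s (s≤s (z≤n {2})))) (m≤m+n (4 * n) (2 * C)))

  m≤m-bound : m ≤ m-bound μ n
  m≤m-bound = ≤-trans m≤T T≤4n+2C

replication-excess : ∀ {r λ′ μ₁ m₁} → 1 ≤ λ′ → 1 ≤ μ₁ → 1 ≤ m₁ → r + suc μ₁ ≡ λ′ + suc μ₁ * suc m₁ → suc m₁ < r
replication-excess {r} {suc l} {suc μ₂} {suc m₂} _ _ _ eq = +-cancelʳ-≤ (2 + μ₂) (3 + m₂) r (begin
  3 + m₂ + (2 + μ₂)            ≤⟨ m≤m+n (3 + m₂ + (2 + μ₂)) (l + (m₂ + μ₂ * (1 + m₂))) ⟩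
  3 + m₂ + (2 + μ₂) + (l + (m₂ + μ₂ * (1 + m₂)))   ≡⟨ regroup l m₂ μ₂ ⟩
  suc l + (2 + μ₂) * (2 + m₂)  ≡⟨ eq ⟨
  r + (2 + μ₂)                 ∎)
  where
  open ≤-Reasoning
  regroup : ∀ l m₂ μ₂ → 3 + m₂ + (2 + μ₂) + (l + (m₂ + μ₂ * (1 + m₂))) ≡ suc l + (2 + μ₂) * (2 + m₂)
  regroup = solve-∀

b-bound v-bound : ℕ → ℕ → ℕ
b-bound μ n = (m-bound μ n * n + 1) * m-bound μ n
v-bound μ n = (μ * n * b-bound μ n + μ * n) * b-bound μ n + (b-bound μ n + μ)

module DefectAtLeastTwo {m₁ n₁ μ₁ D λ₁} (1≤m₁ : 1 ≤ m₁) (1≤n₁ : 1 ≤ n₁) (1≤μ₁ : 1 ≤ μ₁)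
  (P : Parameters (suc m₁) (suc n₁) D λ₁ (suc μ₁)) where
  open Parameters P

  private
    m n μ : ℕ
    m = suc m₁
    n = suc n₁
    μ = suc μ₁

    positive : ∀ {a c} → 1 ≤ a → 1 ≤ c → 1 ≤ a * c
    positive {a} {c} = *-mono-≤ {1} {a} {1} {c}

    1≤λ′ : 1 ≤ λ′
    1≤λ′ = proj₁ (proj₂ isDesign)

    m<r : m < r
    m<r = replication-excess 1≤λ′ 1≤μ₁ 1≤m₁ r+μ≡λ′+μm

    u : ℕ
    u = r ∸ m
    r≡m+u : r ≡ m + u
    r≡m+u = sym (m+[n∸m]≡n (<⇒≤ m<r))
    1≤u : 1 ≤ u
    1≤u = +-cancelˡ-≤ m 1 u (subst₂ _≤_ (+-comm 1 m) r≡m+u m<r)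

    excess : Σ ℕ λ t → b D ≡ m + t × t * n ≡ m * m₁ * n₁
    excess = excess-blocks bn+mm≡[mn+1]m

    t : ℕ
    t = proj₁ excess
    b≡m+t : b D ≡ m + t
    b≡m+t = proj₁ (proj₂ excess)
    1≤t : 1 ≤ t
    1≤t = positive-factor (proj₂ (proj₂ excess)) (positive (positive (s≤s (z≤n {m₁})) 1≤m₁) 1≤n₁)
      where
      positive-factor : ∀ {a c d} → a * c ≡ d → 1 ≤ d → 1 ≤ a
      positive-factor {zero} refl ()
      positive-factor {suc _} _ _ = s≤s z≤n

    r<t : r < t
    r<t = ≰⇒> t≰r
      where
      t≰r : ¬ t ≤ r
      t≰r t≤r = <⇒≢ (positive (positive (positive (positive 1≤μ₁ 1≤m₁) (subst (1 ≤_) (sym b≡m+t) (s≤s z≤n))) (s≤s z≤n)) 1≤t)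
                    (sym (m+n≡0⇒n≡0 _ (μ≥2-sign P r≡m+u b≡m+t (m+[n∸m]≡n t≤r))))
        where open ℕ→ℤ

    w : ℕ
    w = t ∸ r
    t≡r+w : t ≡ r + w
    t≡r+w = sym (m+[n∸m]≡n (<⇒≤ r<t))
    1≤w : 1 ≤ w
    1≤w = +-cancelˡ-≤ r 1 w (subst₂ _≤_ (+-comm 1 r) t≡r+w r<t)

    λ₁≡ : λ₁ * (m + w) ≡ μ * n * u
    λ₁≡ = ℕ→ℤ.λ₁-identity P r≡m+u t≡r+w b≡m+t

    open DefectBound {m₁} {n₁} {μ₁} {u} {w} {λ₁} {outside} {r} {t} {b D} 1≤n₁ 1≤u 1≤w r≡m+u t≡r+w b≡m+t (ℕ→ℤ.μ≥2-split P r≡m+u t≡r+w b≡m+t) λ₁≡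
      (ℕ→ℤ.outside-identity P t≡r+w b≡m+t) (proj₂ (proj₂ excess))

  b≤b-bound : b D ≤ b-bound μ n
  b≤b-bound = begin
    b D                  ≤⟨ m≤m*n (b D) n ⟩
    b D * n              ≤⟨ m≤m+n (b D * n) (m * m) ⟩
    b D * n + m * m      ≡⟨ bn+mm≡[mn+1]m ⟩
    (m * n + 1) * m      ≤⟨ *-mono-≤ (+-monoˡ-≤ 1 (*-monoˡ-≤ n m≤m-bound)) m≤m-bound ⟩
    (m-bound μ n * n + 1) * m-bound μ n ∎
    where open ≤-Reasoning

  v≤v-bound : v D ≤ v-bound μ n
  v≤v-bound = begin
    v D                                          ≤⟨ m≤m*n (v D) λ′ {{>-nonZero 1≤λ′}} ⟩
    v D * λ′                                     ≤⟨ m≤m+n (v D * λ′) r ⟩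
    v D * λ′ + r                                 ≡⟨ kr+λ′≡vλ′+r ⟨
    k * r + λ′                                   ≤⟨ +-mono-≤ (*-mono-≤ k≤ r≤b) λ′≤ ⟩
    (μ * n * b D + μ * n) * b D + (b D + μ)      ≤⟨ +-mono-≤ (*-mono-≤ (+-monoˡ-≤ (μ * n) (*-monoʳ-≤ (μ * n) b≤b-bound)) b≤b-bound)
                                                             (+-monoˡ-≤ μ b≤b-bound) ⟩
    v-bound μ n                                  ∎
    where
    open ≤-Reasoning
    u≤b : u ≤ b D
    u≤b = ≤-trans (m≤n+m u m) (≤-trans (≤-reflexive (sym r≡m+u)) r≤b)
    λ₁≤ : λ₁ ≤ μ * n * b D
    λ₁≤ = ≤-trans (m≤m*n λ₁ (m + w)) (≤-trans (≤-reflexive λ₁≡) (*-monoʳ-≤ (μ * n) u≤b))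
    k≤ : k ≤ μ * n * b D + μ * n
    k≤ = subst (_≤ μ * n * b D + μ * n) (sym k≡λ₁+μn) (+-monoˡ-≤ (μ * n) λ₁≤)
    λ′≤ : λ′ ≤ b D + μ
    λ′≤ = ≤-trans (m≤m+n λ′ (μ * m)) (≤-trans (≤-reflexive (sym r+μ≡λ′+μm)) (+-monoˡ-≤ μ r≤b))

subsets : ∀ v → List (Subset v)
subsets zero = [] ∷ []
subsets (suc v) = map (true ∷_) (subsets v) ++ map (false ∷_) (subsets v)

∈-subsets : ∀ {v} (p : Subset v) → p ∈ subsets v
∈-subsets [] = here refl
∈-subsets {suc v} (true ∷ p) = ∈-++⁺ˡ (∈-map⁺ (true ∷_) (∈-subsets p))
∈-subsets {suc v} (false ∷ p) = ∈-++⁺ʳ (map (true ∷_) (subsets v)) (∈-map⁺ (false ∷_) (∈-subsets p))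

families : ∀ b v → List (Fin b → Subset v)
families zero v = V.[] ∷ []
families (suc b) v = concatMap (λ s → map (s V.∷_) (families b v)) (subsets v)

∈-families : ∀ {b v} (f : Fin b → Subset v) → Any (λ g → ∀ i → f i ≡ g i) (families b v)
∈-families {zero} f = here (λ ())
∈-families {suc b} {v} f = concatMap⁺ (λ s → map (s V.∷_) (families b v)) (Any.map (λ { refl → map⁺ (Any.map extend (∈-families (λ i → f (suc i)))) }) (∈-subsets (f zero)))
  where
  extend : ∀ {g} → (∀ i → f (suc i) ≡ g i) → ∀ i → f i ≡ (f zero V.∷ g) i
  extend f∘suc≗g zero = refl
  extend f∘suc≗g (suc i) = f∘suc≗g i

designs-upto : ℕ → ℕ → List Design
designs-upto V B = concatMap (λ v → concatMap (λ b → map (design v b) (families b v)) (upTo (suc B))) (upTo (suc V))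

∈-designs-upto : ∀ {V B} (D : Design) → v D ≤ V → b D ≤ B → Any (D ≅D_) (designs-upto V B)
∈-designs-upto {V} {B} (design v b blocks) v≤V b≤B =
  concatMap⁺ (λ v → concatMap (λ b → map (design v b) (families b v)) (upTo (suc B)))
    (Any.map (λ { refl → concatMap⁺ (λ b → map (design v b) (families b v))
                           (Any.map (λ { refl → map⁺ (Any.map identity (∈-families blocks)) })
                                                         (∈-upTo⁺ (s≤s b≤B))) })
                      (∈-upTo⁺ (s≤s v≤V)))
  where
  identity : ∀ {blocks′} → (∀ i → blocks i ≡ blocks′ i) → design v b blocks ≅D design v b blocks′
  identity blocks≗ = ↔-id _ , ↔-id _ , λ x i → cong (λ s → lookup s x) (blocks≗ i)

defect-one : (m n : ℕ) → 2 ≤ n → n < m → n ∣ m * (m ∸ 1) →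
  (D : Design) (λ₁ λ₂ : ℕ) → IsQuasiSymmetric D λ₁ λ₂ → λ₂ ≡ λ₁ + 1 →
  IsSteinerGraph n m (qsBlockGraph D λ₂) → IsSteiner D ⊎ IsSteiner (complement D)
defect-one zero n _ () _ _ _ _ _ _ _
defect-one (suc m₁) (suc n₁) 2≤n@(s≤s 1≤n₁) n<m@(s≤s n₁<m₁) _ D λ₁ λ₂ qs λ₂≡λ₁+1 sg =
  defect-one-parameters (≤-trans 1≤n₁ (<⇒≤ n₁<m₁)) (SteinerGraphParameters.parameters 2≤n n<m D qs λ₂≡λ₁+1 sg)

finitely-many : (μ n : ℕ) → 2 ≤ μ → 2 ≤ n →
  Σ (List Design) λ L → (D : Design) (λ₁ λ₂ : ℕ) → IsQuasiSymmetric D λ₁ λ₂ → λ₂ ≡ λ₁ + μ →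
    Σ ℕ (λ m → IsSteinerGraph n m (qsBlockGraph D λ₂)) → Any (D ≅D_) L
finitely-many (suc μ₁) (suc n₁) (s≤s 1≤μ₁) (s≤s 1≤n₁) = designs-upto (v-bound (suc μ₁) (suc n₁)) (b-bound (suc μ₁) (suc n₁)) , covered
  where
  covered : (D : Design) (λ₁ λ₂ : ℕ) → IsQuasiSymmetric D λ₁ λ₂ → λ₂ ≡ λ₁ + suc μ₁ →
    Σ ℕ (λ m → IsSteinerGraph (suc n₁) m (qsBlockGraph D λ₂)) → Any (D ≅D_) (designs-upto (v-bound (suc μ₁) (suc n₁)) (b-bound (suc μ₁) (suc n₁)))
  covered D λ₁ λ₂ qs λ₂≡λ₁+μ (zero , sg) = contradiction (proj₁ (proj₂ sg)) (λ ())
  covered D λ₁ λ₂ qs λ₂≡λ₁+μ (suc m₁ , sg) = ∈-designs-upto D v≤v-bound b≤b-bound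
    where
    1≤m₁ : 1 ≤ m₁
    1≤m₁ = ≤-trans 1≤n₁ (<⇒≤ (≤-pred (proj₁ (proj₂ sg))))
    open DefectAtLeastTwo 1≤m₁ 1≤n₁ 1≤μ₁ (SteinerGraphParameters.parameters (proj₁ sg) (proj₁ (proj₂ sg)) D qs λ₂≡λ₁+μ sg)

corollary2p8 : ((m n : ℕ) → 2 ≤ n → n < m → n ∣ m * (m ∸ 1) →
    (D : Design) (λ₁ λ₂ : ℕ) → IsQuasiSymmetric D λ₁ λ₂ → λ₂ ≡ λ₁ + 1 →
    IsSteinerGraph n m (qsBlockGraph D λ₂) →
    IsSteiner D ⊎ IsSteiner (complement D))
    ×
    ((μ n : ℕ) → 2 ≤ μ → 2 ≤ n →
    Σ (List Design) λ L →
    (D : Design) (λ₁ λ₂ : ℕ) → IsQuasiSymmetric D λ₁ λ₂ → λ₂ ≡ λ₁ + μ →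
    Σ ℕ (λ m → IsSteinerGraph n m (qsBlockGraph D λ₂)) →
    Any (D ≅D_) L)
corollary2p8 = defect-one , finitely-many
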